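{- Let $l=5$, $r\in\{1,2\}$ and $a=[r]$. Then $p_{4,2}(1/a)$, $p_{4,1}(1/a)$ and $p_{8,3}(1/a)$ are in $S$.
   Context: For an integer $i$, $[i]=\sum x^{n^2}\in\mathbb{Z}/2[[x]]$, summed over $n\in\mathbb{Z}$ with $n\equiv i\pmod 5$. $S=\mathbb{Z}/2[[1],[2]]\subset\mathbb{Z}/2[[x]]$ is the subring generated by $[1]$ and $[2]$. $1/a$ is taken in the field $L$ of Laurent series over $\mathbb{Z}/2$. For $q$ a power of $2$ and $0\le j<q$, $p_{q,j}:L\to L$ is $\sum_n c_nx^n\mapsto\sum_{n\equiv j\pmod q}c_nx^n$. -}

module Defs where

open import Data.Bool using (Bool; true; false; _xor_; _∧_; if_then_else_)
open import Data.Nat as ℕ using (ℕ; zero; suc; _≡ᵇ_)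
open import Data.Integer as ℤ using (ℤ; +_; -[1+_]; _-_; _*_; _+_)
open import Data.Integer.DivMod using (_%ℕ_)
open import Data.List using (List; []; _∷_; map; foldr; upTo)
open import Data.Product using (Σ; _×_; _,_)
open import Relation.Nullary using (does)
open import Relation.Binary.PropositionalEquality using (_≡_)

-- Z/2 is represented by Bool (xor = addition, ∧ = multiplication).
-- Formal power series over Z/2: coefficient function.
PS : Set
PS = ℕ → Bool

xorSum : List Bool → Bool
xorSum = foldr _xor_ false

_⊕_ : PS → PS → PS
(f ⊕ g) n = f n xor g n

_⊛_ : PS → PS → PS
(f ⊛ g) n = xorSum (map (λ i → f i ∧ g (n ℕ.∸ i)) (upTo (suc n)))

zeroPS : PS
zeroPS _ = false

onePS : PS
onePS n = n ≡ᵇ 0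

xpow : ℕ → PS
xpow N n = N ≡ᵇ n

_^PS_ : PS → ℕ → PS
f ^PS zero = onePS
f ^PS suc k = f ⊛ (f ^PS k)

-- [i] = Σ_{n ∈ ℤ, n ≡ i mod 5} x^{n^2}.  The coefficient of x^m is the parity
-- of #{ n ∈ ℤ : n^2 = m, n ≡ i (mod 5) }; such n satisfy -m ≤ n ≤ m.
bracket : ℤ → PS
bracket i m = xorSum (map term (upTo (suc (2 ℕ.* m))))
  where
  term : ℕ → Bool
  term k = let n = (+ k) - (+ m) in
           does ((n * n) ℤ.≟ (+ m)) ∧ ((n - i) %ℕ 5 ≡ᵇ 0)

-- Polynomials in two variables over Z/2: list of monomials u^a v^b
-- (a monomial occurring twice cancels, as in Z/2).
Poly2 : Set
Poly2 = List (ℕ × ℕ)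

-- Evaluation at u = [1], v = [2]; the image is exactly S = Z/2[[1],[2]].
evalS : Poly2 → PS
evalS [] = zeroPS
evalS ((a , b) ∷ P) = ((bracket (+ 1) ^PS a) ⊛ (bracket (+ 2) ^PS b)) ⊕ evalS P

-- Laurent series over Z/2 as coefficient functions ℤ → Bool.
-- lc N g is the Laurent series x^{-N} · g.
lcAux : PS → ℤ → Bool
lcAux g (+ k) = g k
lcAux g -[1+ _ ] = false

lc : ℕ → PS → ℤ → Bool
lc N g e = lcAux g (e + (+ N))

psL : PS → ℤ → Bool
psL = lc 0

proj : (q : ℕ) → .{{_ : ℕ.NonZero q}} → ℕ → (ℤ → Bool) → (ℤ → Bool)
proj q j F e = if ((e - (+ j)) %ℕ q ≡ᵇ 0) then F e else false

InS : (ℤ → Bool) → Set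
InS F = Σ Poly2 λ P → ∀ e → F e ≡ psL (evalS P) e

-- With u = [1] and v = [2], 1/a = a¹⁵/a¹⁶ for a ∈ {u, v}, and a¹⁶ has only exponents ≡ 0 (mod 16),
-- so p_{q,j} commutes with division by a¹⁶ and it suffices to project a¹⁵. Let b be the other bracket
-- and write a = x + y with x = b⁴, y = a + b⁴. Counting representations by binary quadratic forms
-- shows that the exponents of y are ≡ 1 (mod 8) and that u⁵ + v⁵ + uv + u²v² = 0. Hence p_{q,j}
-- keeps some of the monomials xⁱyᵏ of (x + y)¹⁵, and rewritten in a and b their sum is a¹⁶ P
-- modulo the quintic relation, for an explicit polynomial P; this is checked by normalisation.

module Submission where

open import Data.Bool using (true; false)
open import Data.Nat as ℕ using (ℕ; zero; suc; _%_; _<_; z≤n; s≤s; NonZero)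
open import Data.Nat.Divisibility using (divides)
open import Data.Integer using (+_)
open import Data.Product using (_×_; _,_)
open import Data.Sum using (_⊎_; inj₁; inj₂)
open import Function using (id)
open import Relation.Binary.PropositionalEquality
open import Defs

module BoolSums where

  open import Data.Bool using (Bool; true; false; _xor_; _∧_)
  open import Data.Bool.Properties
    using (xor-assoc; xor-comm; xor-same; xor-identityʳ; xor-∧-commutativeRing; ∧-comm; ∧-distribˡ-xor; ∧-distribʳ-xor)
  open import Data.Nat using (ℕ; zero; suc; _+_; _∸_; _<_; _≡ᵇ_; z≤n; s≤s)
  open import Data.Nat.Properties using (suc-injective)
  open import Data.List using (map; foldr; upTo; applyUpTo)
  open import Data.Product using (Σ; ∃₂; _×_; _,_)
  open import Function using (_∘_)
  open import Relation.Binary.PropositionalEquality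
  open import Algebra.Bundles using (CommutativeRing)
  open import Algebra.Properties.CommutativeSemigroup
    (CommutativeRing.+-commutativeSemigroup xor-∧-commutativeRing) using (interchange)
  open import Defs using (xorSum)

  sumBelow : ℕ → (ℕ → Bool) → Bool
  sumBelow zero    f = false
  sumBelow (suc n) f = f 0 xor sumBelow n (f ∘ suc)

  xorSum-upTo : ∀ (f : ℕ → Bool) n → xorSum (map f (upTo n)) ≡ sumBelow n f
  xorSum-upTo f n = go f (λ i → i) n
    where
    go : ∀ (f : ℕ → Bool) (g : ℕ → ℕ) n → foldr _xor_ false (map f (applyUpTo g n)) ≡ sumBelow n (f ∘ g)
    go f g zero    = refl
    go f g (suc n) = cong (f (g 0) xor_) (go f (g ∘ suc) n)

  sumBelow-cong : ∀ n {f g : ℕ → Bool} → (∀ i → i < n → f i ≡ g i) → sumBelow n f ≡ sumBelow n g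
  sumBelow-cong zero    h = refl
  sumBelow-cong (suc n) h = cong₂ _xor_ (h 0 (s≤s z≤n)) (sumBelow-cong n (λ i i<n → h (suc i) (s≤s i<n)))

  sumBelow-zero : ∀ n (f : ℕ → Bool) → (∀ i → f i ≡ false) → sumBelow n f ≡ false
  sumBelow-zero zero    f h = refl
  sumBelow-zero (suc n) f h = cong₂ _xor_ (h 0) (sumBelow-zero n (f ∘ suc) (h ∘ suc))

  sumBelow-xor : ∀ n (f g : ℕ → Bool) → sumBelow n (λ i → f i xor g i) ≡ sumBelow n f xor sumBelow n g
  sumBelow-xor zero    f g = refl
  sumBelow-xor (suc n) f g =
    trans (cong ((f 0 xor g 0) xor_) (sumBelow-xor n (f ∘ suc) (g ∘ suc))) (interchange (f 0) (g 0) _ _)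

  sumBelow-∧ʳ : ∀ n b (f : ℕ → Bool) → sumBelow n f ∧ b ≡ sumBelow n (λ i → f i ∧ b)
  sumBelow-∧ʳ zero    b f = refl
  sumBelow-∧ʳ (suc n) b f = trans (∧-distribʳ-xor b (f 0) _) (cong ((f 0 ∧ b) xor_) (sumBelow-∧ʳ n b (f ∘ suc)))

  sumBelow-swap : ∀ n m (G : ℕ → ℕ → Bool) →
    sumBelow n (λ i → sumBelow m (G i)) ≡ sumBelow m (λ j → sumBelow n (λ i → G i j))
  sumBelow-swap zero    m G = sym (sumBelow-zero m _ (λ _ → refl))
  sumBelow-swap (suc n) m G = trans (cong (sumBelow m (G 0) xor_) (sumBelow-swap n m (G ∘ suc))) (sym (sumBelow-xor m (G 0) _))

  sumBelow-single : ∀ n k (f : ℕ → Bool) → (∀ i → f i ≡ true → i ≡ k) → k < n → sumBelow n f ≡ f k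
  sumBelow-single (suc n) zero f h _ =
    trans (cong (f 0 xor_) (sumBelow-zero n (f ∘ suc) off)) (xor-identityʳ (f 0))
    where
    off : ∀ i → f (suc i) ≡ false
    off i with f (suc i) in eq
    ... | false = refl
    ... | true with () ← h (suc i) eq
  sumBelow-single (suc n) (suc k) f h (s≤s k<n) =
    trans (cong (_xor sumBelow n (f ∘ suc)) off) (sumBelow-single n k (f ∘ suc) (λ i e → suc-injective (h (suc i) e)) k<n)
    where
    off : f 0 ≡ false
    off with f 0 in eq
    ... | false = refl
    ... | true with () ← h 0 eq

  sumBelow-witness : ∀ n (f : ℕ → Bool) → sumBelow n f ≡ true → Σ ℕ λ i → f i ≡ true
  sumBelow-witness (suc n) f e with f 0 in e0
  ... | true  = 0 , e0
  ... | false with sumBelow-witness n (f ∘ suc) e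
  ... | i , ei = suc i , ei

  sumAntidiagonal : ℕ → (ℕ → ℕ → Bool) → Bool
  sumAntidiagonal zero    F = F 0 0
  sumAntidiagonal (suc n) F = F 0 (suc n) xor sumAntidiagonal n (λ i → F (suc i))

  sumBelow-antidiagonal : ∀ n (F : ℕ → ℕ → Bool) → sumBelow (suc n) (λ i → F i (n ∸ i)) ≡ sumAntidiagonal n F
  sumBelow-antidiagonal zero    F = xor-identityʳ (F 0 0)
  sumBelow-antidiagonal (suc n) F = cong (F 0 (suc n) xor_) (sumBelow-antidiagonal n (λ i → F (suc i)))

  sumAntidiagonal-cong : ∀ n {F G : ℕ → ℕ → Bool} → (∀ i j → i + j ≡ n → F i j ≡ G i j) →
    sumAntidiagonal n F ≡ sumAntidiagonal n G
  sumAntidiagonal-cong zero    h = h 0 0 refl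
  sumAntidiagonal-cong (suc n) h =
    cong₂ _xor_ (h 0 (suc n) refl) (sumAntidiagonal-cong n (λ i j e → h (suc i) j (cong suc e)))

  sumAntidiagonal-zero : ∀ n (F : ℕ → ℕ → Bool) → (∀ i j → i + j ≡ n → F i j ≡ false) → sumAntidiagonal n F ≡ false
  sumAntidiagonal-zero zero    F h = h 0 0 refl
  sumAntidiagonal-zero (suc n) F h =
    cong₂ _xor_ (h 0 (suc n) refl) (sumAntidiagonal-zero n (λ i → F (suc i)) (λ i j e → h (suc i) j (cong suc e)))

  sumAntidiagonal-xor : ∀ n (F G : ℕ → ℕ → Bool) →
    sumAntidiagonal n (λ i j → F i j xor G i j) ≡ sumAntidiagonal n F xor sumAntidiagonal n G
  sumAntidiagonal-xor zero    F G = refl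
  sumAntidiagonal-xor (suc n) F G =
    trans (cong ((F 0 (suc n) xor G 0 (suc n)) xor_) (sumAntidiagonal-xor n (λ i → F (suc i)) (λ i → G (suc i))))
          (interchange (F 0 (suc n)) (G 0 (suc n)) _ _)

  sumAntidiagonal-∧ˡ : ∀ n b (F : ℕ → ℕ → Bool) → b ∧ sumAntidiagonal n F ≡ sumAntidiagonal n (λ i j → b ∧ F i j)
  sumAntidiagonal-∧ˡ zero    b F = refl
  sumAntidiagonal-∧ˡ (suc n) b F =
    trans (∧-distribˡ-xor b _ _) (cong (b ∧ F 0 (suc n) xor_) (sumAntidiagonal-∧ˡ n b (λ i → F (suc i))))

  sumAntidiagonal-∧ʳ : ∀ n b (F : ℕ → ℕ → Bool) → sumAntidiagonal n F ∧ b ≡ sumAntidiagonal n (λ i j → F i j ∧ b)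
  sumAntidiagonal-∧ʳ n b F = trans (∧-comm (sumAntidiagonal n F) b)
    (trans (sumAntidiagonal-∧ˡ n b F) (sumAntidiagonal-cong n (λ i j _ → ∧-comm b (F i j))))

  sumAntidiagonal-sumBelow : ∀ n m (G : ℕ → ℕ → ℕ → Bool) →
    sumAntidiagonal n (λ i j → sumBelow m (λ a → G a i j)) ≡ sumBelow m (λ a → sumAntidiagonal n (G a))
  sumAntidiagonal-sumBelow n zero    G = sumAntidiagonal-zero n _ (λ _ _ _ → refl)
  sumAntidiagonal-sumBelow n (suc m) G =
    trans (sumAntidiagonal-xor n _ _) (cong (sumAntidiagonal n (G 0) xor_) (sumAntidiagonal-sumBelow n m (G ∘ suc)))

  sumAntidiagonal-last : ∀ n (F : ℕ → ℕ → Bool) →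
    sumAntidiagonal (suc n) F ≡ sumAntidiagonal n (λ i j → F i (suc j)) xor F (suc n) 0
  sumAntidiagonal-last zero    F = refl
  sumAntidiagonal-last (suc n) F =
    trans (cong (F 0 (suc (suc n)) xor_) (sumAntidiagonal-last n (λ i → F (suc i))))
          (sym (xor-assoc (F 0 (suc (suc n))) _ _))

  sumAntidiagonal-swap : ∀ n (F : ℕ → ℕ → Bool) → sumAntidiagonal n F ≡ sumAntidiagonal n (λ i j → F j i)
  sumAntidiagonal-swap zero    F = refl
  sumAntidiagonal-swap (suc n) F = begin
    F 0 (suc n) xor sumAntidiagonal n (λ i → F (suc i))   ≡⟨ cong (F 0 (suc n) xor_) (sumAntidiagonal-swap n _) ⟩
    F 0 (suc n) xor sumAntidiagonal n (λ i j → F (suc j) i) ≡⟨ xor-comm (F 0 (suc n)) _ ⟩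
    sumAntidiagonal n (λ i j → F (suc j) i) xor F 0 (suc n) ≡⟨ sym (sumAntidiagonal-last n (λ i j → F j i)) ⟩
    sumAntidiagonal (suc n) (λ i j → F j i)                 ∎
    where open ≡-Reasoning

  sumAntidiagonal-assoc : ∀ n (T : ℕ → ℕ → ℕ → Bool) →
    sumAntidiagonal n (λ a k → sumAntidiagonal a (λ i j → T i j k)) ≡
    sumAntidiagonal n (λ i b → sumAntidiagonal b (T i))
  sumAntidiagonal-assoc zero    T = refl
  sumAntidiagonal-assoc (suc n) T = begin
    T 0 0 (suc n) xor sumAntidiagonal n (λ a k → sumAntidiagonal (suc a) (λ i j → T i j k))
      ≡⟨ cong (T 0 0 (suc n) xor_) (sumAntidiagonal-xor n (λ a → T 0 (suc a)) _) ⟩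
    T 0 0 (suc n) xor (sumAntidiagonal n (λ a → T 0 (suc a)) xor
                       sumAntidiagonal n (λ a k → sumAntidiagonal a (λ i j → T (suc i) j k)))
      ≡⟨ cong (λ z → T 0 0 (suc n) xor (sumAntidiagonal n (λ a → T 0 (suc a)) xor z))
              (sumAntidiagonal-assoc n (T ∘ suc)) ⟩
    T 0 0 (suc n) xor (sumAntidiagonal n (λ a → T 0 (suc a)) xor
                       sumAntidiagonal n (λ i b → sumAntidiagonal b (T (suc i))))
      ≡⟨ sym (xor-assoc (T 0 0 (suc n)) _ _) ⟩
    sumAntidiagonal (suc n) (T 0) xor sumAntidiagonal n (λ i b → sumAntidiagonal b (T (suc i))) ∎
    where open ≡-Reasoning

  sumAntidiagonal-square : ∀ n (f : ℕ → Bool) →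
    sumAntidiagonal (suc (suc n)) (λ i j → f i ∧ f j) ≡ sumAntidiagonal n (λ i j → f (suc i) ∧ f (suc j))
  sumAntidiagonal-square n f = begin
    a xor sumAntidiagonal (suc n) (λ i j → f (suc i) ∧ f j)
      ≡⟨ cong (a xor_) (sumAntidiagonal-last n (λ i j → f (suc i) ∧ f j)) ⟩
    a xor (inner xor (f (suc (suc n)) ∧ f 0))
      ≡⟨ cong (λ z → a xor (inner xor z)) (∧-comm (f (suc (suc n))) (f 0)) ⟩
    a xor (inner xor a)   ≡⟨ cong (a xor_) (xor-comm inner a) ⟩
    a xor (a xor inner)   ≡⟨ sym (xor-assoc a a inner) ⟩
    (a xor a) xor inner   ≡⟨ cong (_xor inner) (xor-same a) ⟩
    inner                 ∎
    where
    open ≡-Reasoning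
    a = f 0 ∧ f (suc (suc n))
    inner = sumAntidiagonal n (λ i j → f (suc i) ∧ f (suc j))

  sumAntidiagonal-indicator : ∀ m s t → sumAntidiagonal m (λ i j → (s ≡ᵇ i) ∧ (t ≡ᵇ j)) ≡ (s + t ≡ᵇ m)
  sumAntidiagonal-indicator zero    zero    t = refl
  sumAntidiagonal-indicator zero    (suc s) t = refl
  sumAntidiagonal-indicator (suc m) zero    t =
    trans (cong ((t ≡ᵇ suc m) xor_) (sumAntidiagonal-zero m _ (λ _ _ _ → refl))) (xor-identityʳ _)
  sumAntidiagonal-indicator (suc m) (suc s) t = sumAntidiagonal-indicator m s t

  sumAntidiagonal-shift : ∀ d n (F : ℕ → ℕ → Bool) → (∀ i j → i < d → F i j ≡ false) →
    sumAntidiagonal (d + n) F ≡ sumAntidiagonal n (λ i → F (d + i))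
  sumAntidiagonal-shift zero    n F h = refl
  sumAntidiagonal-shift (suc d) n F h =
    trans (cong (_xor sumAntidiagonal (d + n) (λ i → F (suc i))) (h 0 (suc (d + n)) (s≤s z≤n)))
          (sumAntidiagonal-shift d n (λ i → F (suc i)) (λ i j i<d → h (suc i) j (s≤s i<d)))

  sumAntidiagonal-witness : ∀ n (F : ℕ → ℕ → Bool) → sumAntidiagonal n F ≡ true →
    ∃₂ λ i j → i + j ≡ n × F i j ≡ true
  sumAntidiagonal-witness zero    F e = 0 , 0 , refl , e
  sumAntidiagonal-witness (suc n) F e with F 0 (suc n) in e0
  ... | true  = 0 , suc n , refl , e0
  ... | false with sumAntidiagonal-witness n (λ i → F (suc i)) e
  ... | i , j , i+j≡n , Fij = suc i , j , cong suc i+j≡n , Fij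

module PowerSeries where

  open import Data.Bool using (Bool; true; false; _xor_; _∧_)
  open import Data.Bool.Properties
    using (xor-same; xor-identityʳ; ∧-comm; ∧-assoc; ∧-idem; ∧-distribˡ-xor)
  open import Data.Nat using (ℕ; zero; suc; _+_; _∸_; _<_; _≡ᵇ_; s≤s)
  open import Data.Nat.Properties using (+-suc)
  open import Function using (_∘_)
  open import Level using (0ℓ)
  open import Relation.Binary.Bundles using (Setoid)
  open import Relation.Binary.PropositionalEquality
  import Relation.Binary.Reasoning.Setoid as SetoidReasoning
  open import Defs
  open BoolSums

  ≗-setoid : Setoid 0ℓ 0ℓ
  ≗-setoid = record
    { Carrier = PS
    ; _≈_ = _≗_
    ; isEquivalence = record { refl = λ _ → refl ; sym = λ p n → sym (p n) ; trans = λ p q n → trans (p n) (q n) }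
    }

  open Setoid ≗-setoid public using () renaming (refl to ≗-refl; sym to ≗-sym; trans to ≗-trans)
  module ≗-Reasoning = SetoidReasoning ≗-setoid

  ⊛-antidiagonal : ∀ f g n → (f ⊛ g) n ≡ sumAntidiagonal n (λ i j → f i ∧ g j)
  ⊛-antidiagonal f g n = trans (xorSum-upTo (λ i → f i ∧ g (n ∸ i)) (suc n)) (sumBelow-antidiagonal n (λ i j → f i ∧ g j))

  ⊛-cong : ∀ {f f′ g g′} → f ≗ f′ → g ≗ g′ → f ⊛ g ≗ f′ ⊛ g′
  ⊛-cong {f} {f′} {g} {g′} p q n = begin
    (f ⊛ g) n                              ≡⟨ ⊛-antidiagonal f g n ⟩
    sumAntidiagonal n (λ i j → f i ∧ g j)   ≡⟨ sumAntidiagonal-cong n (λ i j _ → cong₂ _∧_ (p i) (q j)) ⟩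
    sumAntidiagonal n (λ i j → f′ i ∧ g′ j) ≡⟨ sym (⊛-antidiagonal f′ g′ n) ⟩
    (f′ ⊛ g′) n                            ∎
    where open ≡-Reasoning

  ⊛-congˡ : ∀ f {g g′} → g ≗ g′ → f ⊛ g ≗ f ⊛ g′
  ⊛-congˡ f = ⊛-cong {f} {f} ≗-refl

  ⊛-congʳ : ∀ g {f f′} → f ≗ f′ → f ⊛ g ≗ f′ ⊛ g
  ⊛-congʳ g p = ⊛-cong {g = g} {g} p ≗-refl

  ⊕-cong : ∀ {f f′ g g′} → f ≗ f′ → g ≗ g′ → f ⊕ g ≗ f′ ⊕ g′
  ⊕-cong p q n = cong₂ _xor_ (p n) (q n)

  ⊛-comm : ∀ f g → f ⊛ g ≗ g ⊛ f
  ⊛-comm f g n = begin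
    (f ⊛ g) n                              ≡⟨ ⊛-antidiagonal f g n ⟩
    sumAntidiagonal n (λ i j → f i ∧ g j)   ≡⟨ sumAntidiagonal-swap n _ ⟩
    sumAntidiagonal n (λ i j → f j ∧ g i)   ≡⟨ sumAntidiagonal-cong n (λ i j _ → ∧-comm (f j) (g i)) ⟩
    sumAntidiagonal n (λ i j → g i ∧ f j)   ≡⟨ sym (⊛-antidiagonal g f n) ⟩
    (g ⊛ f) n                              ∎
    where open ≡-Reasoning

  ⊛-assoc : ∀ f g h → (f ⊛ g) ⊛ h ≗ f ⊛ (g ⊛ h)
  ⊛-assoc f g h n = begin
    ((f ⊛ g) ⊛ h) n
      ≡⟨ ⊛-antidiagonal (f ⊛ g) h n ⟩
    sumAntidiagonal n (λ a k → (f ⊛ g) a ∧ h k)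
      ≡⟨ sumAntidiagonal-cong n (λ a k _ → trans (cong (_∧ h k) (⊛-antidiagonal f g a)) (sumAntidiagonal-∧ʳ a (h k) _)) ⟩
    sumAntidiagonal n (λ a k → sumAntidiagonal a (λ i j → (f i ∧ g j) ∧ h k))
      ≡⟨ sumAntidiagonal-assoc n (λ i j k → (f i ∧ g j) ∧ h k) ⟩
    sumAntidiagonal n (λ i b → sumAntidiagonal b (λ j k → (f i ∧ g j) ∧ h k))
      ≡⟨ sumAntidiagonal-cong n (λ i b _ → trans (sumAntidiagonal-cong b (λ j k _ → ∧-assoc (f i) (g j) (h k)))
                                             (sym (trans (cong (f i ∧_) (⊛-antidiagonal g h b)) (sumAntidiagonal-∧ˡ b (f i) _)))) ⟩
    sumAntidiagonal n (λ i b → f i ∧ (g ⊛ h) b)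
      ≡⟨ sym (⊛-antidiagonal f (g ⊛ h) n) ⟩
    (f ⊛ (g ⊛ h)) n ∎
    where open ≡-Reasoning

  ⊛-distribˡ-⊕ : ∀ f g h → f ⊛ (g ⊕ h) ≗ (f ⊛ g) ⊕ (f ⊛ h)
  ⊛-distribˡ-⊕ f g h n = begin
    (f ⊛ (g ⊕ h)) n
      ≡⟨ ⊛-antidiagonal f (g ⊕ h) n ⟩
    sumAntidiagonal n (λ i j → f i ∧ (g j xor h j))
      ≡⟨ sumAntidiagonal-cong n (λ i j _ → ∧-distribˡ-xor (f i) (g j) (h j)) ⟩
    sumAntidiagonal n (λ i j → (f i ∧ g j) xor (f i ∧ h j))
      ≡⟨ sumAntidiagonal-xor n _ _ ⟩
    sumAntidiagonal n (λ i j → f i ∧ g j) xor sumAntidiagonal n (λ i j → f i ∧ h j)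
      ≡⟨ sym (cong₂ _xor_ (⊛-antidiagonal f g n) (⊛-antidiagonal f h n)) ⟩
    ((f ⊛ g) ⊕ (f ⊛ h)) n ∎
    where open ≡-Reasoning

  ⊛-distribʳ-⊕ : ∀ f g h → (g ⊕ h) ⊛ f ≗ (g ⊛ f) ⊕ (h ⊛ f)
  ⊛-distribʳ-⊕ f g h = ≗-trans (⊛-comm (g ⊕ h) f) (≗-trans (⊛-distribˡ-⊕ f g h) (⊕-cong (⊛-comm f g) (⊛-comm f h)))

  ⊛-identityˡ : ∀ g → onePS ⊛ g ≗ g
  ⊛-identityˡ g n = trans (⊛-antidiagonal onePS g n) (first n)
    where
    first : ∀ n → sumAntidiagonal n (λ i j → (i ≡ᵇ 0) ∧ g j) ≡ g n
    first zero    = refl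
    first (suc n) = trans (cong (g (suc n) xor_) (sumAntidiagonal-zero n _ (λ _ _ _ → refl))) (xor-identityʳ _)

  ⊛-identityʳ : ∀ g → g ⊛ onePS ≗ g
  ⊛-identityʳ g = ≗-trans (⊛-comm g onePS) (⊛-identityˡ g)

  ⊛-zeroˡ : ∀ g → zeroPS ⊛ g ≗ zeroPS
  ⊛-zeroˡ g n = trans (⊛-antidiagonal zeroPS g n) (sumAntidiagonal-zero n _ (λ _ _ _ → refl))

  ⊛-zeroʳ : ∀ g → g ⊛ zeroPS ≗ zeroPS
  ⊛-zeroʳ g = ≗-trans (⊛-comm g zeroPS) (⊛-zeroˡ g)

  ⊕-identityʳ : ∀ f → f ⊕ zeroPS ≗ f
  ⊕-identityʳ f n = xor-identityʳ (f n)

  ⊕-cancel : ∀ f g → f ⊕ g ≗ zeroPS → f ≗ g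
  ⊕-cancel f g h n with f n | g n | h n
  ... | false | false | _ = refl
  ... | true  | true  | _ = refl

  ⊛-interchange : ∀ p q r s → (p ⊛ q) ⊛ (r ⊛ s) ≗ (p ⊛ r) ⊛ (q ⊛ s)
  ⊛-interchange p q r s = begin
    (p ⊛ q) ⊛ (r ⊛ s)  ≈⟨ ⊛-assoc p q (r ⊛ s) ⟩
    p ⊛ (q ⊛ (r ⊛ s))  ≈⟨ ⊛-congˡ p (≗-sym (⊛-assoc q r s)) ⟩
    p ⊛ ((q ⊛ r) ⊛ s)  ≈⟨ ⊛-congˡ p (⊛-congʳ s (⊛-comm q r)) ⟩
    p ⊛ ((r ⊛ q) ⊛ s)  ≈⟨ ⊛-congˡ p (⊛-assoc r q s) ⟩
    p ⊛ (r ⊛ (q ⊛ s))  ≈⟨ ≗-sym (⊛-assoc p r (q ⊛ s)) ⟩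
    (p ⊛ r) ⊛ (q ⊛ s)  ∎
    where open ≗-Reasoning

  -- f(x²), which in characteristic 2 is f²
  substX² : PS → PS
  substX² f zero          = f zero
  substX² f (suc zero)    = false
  substX² f (suc (suc n)) = substX² (f ∘ suc) n

  ⊛-self : ∀ f → f ⊛ f ≗ substX² f
  ⊛-self f n = trans (⊛-antidiagonal f f n) (go n f)
    where
    go : ∀ n f → sumAntidiagonal n (λ i j → f i ∧ f j) ≡ substX² f n
    go zero          f = ∧-idem (f 0)
    go (suc zero)    f = trans (cong (_xor (f 1 ∧ f 0)) (∧-comm (f 0) (f 1))) (xor-same (f 1 ∧ f 0))
    go (suc (suc n)) f = trans (sumAntidiagonal-square n f) (go n (f ∘ suc))

  substX²-cong : ∀ {f g} → f ≗ g → substX² f ≗ substX² g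
  substX²-cong h zero          = h 0
  substX²-cong h (suc zero)    = refl
  substX²-cong h (suc (suc n)) = substX²-cong (h ∘ suc) n

  substX²-even : ∀ f k → substX² f (k + k) ≡ f k
  substX²-even f zero    = refl
  substX²-even f (suc k) rewrite +-suc k k = substX²-even (f ∘ suc) k

  substX²-odd : ∀ f k → substX² f (suc (k + k)) ≡ false
  substX²-odd f zero    = refl
  substX²-odd f (suc k) rewrite +-suc k k = substX²-odd (f ∘ suc) k

  ^-cong : ∀ {f g} k → f ≗ g → f ^PS k ≗ g ^PS k
  ^-cong zero    h = ≗-refl
  ^-cong (suc k) h = ⊛-cong h (^-cong k h)

  ^-+ : ∀ f a b → f ^PS (a + b) ≗ (f ^PS a) ⊛ (f ^PS b)
  ^-+ f zero    b = ≗-sym (⊛-identityˡ _)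
  ^-+ f (suc a) b = ≗-trans (⊛-congˡ f (^-+ f a b)) (≗-sym (⊛-assoc f _ _))

  ^-1 : ∀ f → f ^PS 1 ≗ f
  ^-1 = ⊛-identityʳ

  ^-2 : ∀ f → f ^PS 2 ≗ substX² f
  ^-2 f = ≗-trans (⊛-congˡ f (^-1 f)) (⊛-self f)

  ^-4 : ∀ f → f ^PS 4 ≗ substX² (substX² f)
  ^-4 f = ≗-trans (^-+ f 2 2) (≗-trans (⊛-cong (^-2 f) (^-2 f)) (⊛-self (substX² f)))

  ^-distrib-⊛ : ∀ f g k → (f ⊛ g) ^PS k ≗ (f ^PS k) ⊛ (g ^PS k)
  ^-distrib-⊛ f g zero    = ≗-sym (⊛-identityˡ onePS)
  ^-distrib-⊛ f g (suc k) = ≗-trans (⊛-congˡ (f ⊛ g) (^-distrib-⊛ f g k)) (⊛-interchange f g (f ^PS k) (g ^PS k))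

  ^-double : ∀ f k → f ^PS (k + k) ≗ (f ^PS 2) ^PS k
  ^-double f k = ≗-trans (^-+ f k k) (≗-sym (≗-trans (^-cong k (⊛-congˡ f (^-1 f))) (^-distrib-⊛ f f k)))

  shiftBy : ℕ → PS → PS
  shiftBy zero    f k       = f k
  shiftBy (suc N) f zero    = false
  shiftBy (suc N) f (suc k) = shiftBy N f k

  xpow-⊛ : ∀ N f → xpow N ⊛ f ≗ shiftBy N f
  xpow-⊛ N f k = trans (⊛-antidiagonal (xpow N) f k) (go N k)
    where
    go : ∀ N k → sumAntidiagonal k (λ i j → (N ≡ᵇ i) ∧ f j) ≡ shiftBy N f k
    go zero    zero    = refl
    go (suc N) zero    = refl
    go zero    (suc k) = trans (cong (f (suc k) xor_) (sumAntidiagonal-zero k _ (λ _ _ _ → refl))) (xor-identityʳ _)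
    go (suc N) (suc k) = go N k

  shiftBy-+ : ∀ N f t → shiftBy N f (N + t) ≡ f t
  shiftBy-+ zero    f t = refl
  shiftBy-+ (suc N) f t = shiftBy-+ N f t

  shiftBy-< : ∀ N f k → k < N → shiftBy N f k ≡ false
  shiftBy-< (suc N) f zero    _         = refl
  shiftBy-< (suc N) f (suc k) (s≤s k<N) = shiftBy-< N f k k<N

module Polynomials where

  open import Data.Bool using (Bool; true; false; _xor_; _∧_; _∨_; if_then_else_)
  open import Data.Bool.Properties using (xor-assoc; xor-comm; xor-same; xor-identityʳ)
  open import Data.Nat using (ℕ; zero; suc; _+_; _≡ᵇ_; _<ᵇ_)
  import Data.Nat as ℕ
  open import Data.Integer using (+_)
  open import Data.List using (List; []; _∷_; _++_)
  open import Data.Product using (_×_; _,_)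
  open import Data.Product.Properties using (≡-dec)
  open import Relation.Nullary using (yes; no)
  open import Relation.Binary.PropositionalEquality
  open import Defs
  open PowerSeries

  monomialAt : PS → PS → ℕ × ℕ → PS
  monomialAt x y (a , b) = (x ^PS a) ⊛ (y ^PS b)

  monomialAt-pureˡ : ∀ x y k → monomialAt x y (k , 0) ≗ x ^PS k
  monomialAt-pureˡ x y k = ⊛-identityʳ (x ^PS k)

  monomialAt-pureʳ : ∀ x y k → monomialAt x y (0 , k) ≗ y ^PS k
  monomialAt-pureʳ x y k = ⊛-identityˡ (y ^PS k)

  evalAt : PS → PS → Poly2 → PS
  evalAt x y []      = zeroPS
  evalAt x y (m ∷ P) = monomialAt x y m ⊕ evalAt x y P

  evalS≗evalAt : ∀ P → evalS P ≗ evalAt (bracket (+ 1)) (bracket (+ 2)) P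
  evalS≗evalAt []      n = refl
  evalS≗evalAt (m ∷ P) n = cong (monomialAt (bracket (+ 1)) (bracket (+ 2)) m n xor_) (evalS≗evalAt P n)

  evalAt-cong : ∀ {x x′ y y′} P → x ≗ x′ → y ≗ y′ → evalAt x y P ≗ evalAt x′ y′ P
  evalAt-cong []            hx hy n = refl
  evalAt-cong ((a , b) ∷ P) hx hy = ⊕-cong (⊛-cong (^-cong a hx) (^-cong b hy)) (evalAt-cong P hx hy)

  evalAt-++ : ∀ x y A B → evalAt x y (A ++ B) ≗ evalAt x y A ⊕ evalAt x y B
  evalAt-++ x y []      B n = refl
  evalAt-++ x y (m ∷ A) B n =
    trans (cong (monomialAt x y m n xor_) (evalAt-++ x y A B n)) (sym (xor-assoc (monomialAt x y m n) _ _))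

  swapVars : Poly2 → Poly2
  swapVars []            = []
  swapVars ((a , b) ∷ P) = (b , a) ∷ swapVars P

  evalAt-swapVars : ∀ x y P → evalAt x y P ≗ evalAt y x (swapVars P)
  evalAt-swapVars x y []            n = refl
  evalAt-swapVars x y ((a , b) ∷ P) = ⊕-cong (⊛-comm (x ^PS a) (y ^PS b)) (evalAt-swapVars x y P)

  monomialAt-+ : ∀ x y a b c d → monomialAt x y (a + c , b + d) ≗ monomialAt x y (a , b) ⊛ monomialAt x y (c , d)
  monomialAt-+ x y a b c d = ≗-trans (⊛-cong (^-+ x a c) (^-+ y b d)) (⊛-interchange (x ^PS a) (x ^PS c) (y ^PS b) (y ^PS d))

  _≟ₘ_ : (m h : ℕ × ℕ) → _
  _≟ₘ_ = ≡-dec ℕ._≟_ ℕ._≟_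

  _<ₘ_ : ℕ × ℕ → ℕ × ℕ → Bool
  (a , b) <ₘ (c , d) = (a <ᵇ c) ∨ ((a ≡ᵇ c) ∧ (b <ᵇ d))

  insert : ℕ × ℕ → Poly2 → Poly2
  insert m []      = m ∷ []
  insert m (h ∷ P) with m ≟ₘ h
  ... | yes _ = P
  ... | no  _ = if m <ₘ h then m ∷ h ∷ P else h ∷ insert m P

  normalize : Poly2 → Poly2
  normalize []      = []
  normalize (m ∷ P) = insert m (normalize P)

  evalAt-insert : ∀ x y m P → evalAt x y (insert m P) ≗ monomialAt x y m ⊕ evalAt x y P
  evalAt-insert x y m []      n = refl
  evalAt-insert x y m (h ∷ P) n with m ≟ₘ h
  ... | yes refl = sym (trans (sym (xor-assoc M M _)) (cong (_xor evalAt x y P n) (xor-same M)))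
    where M = monomialAt x y m n
  ... | no _ with m <ₘ h
  ... | true  = refl
  ... | false = begin
    H xor evalAt x y (insert m P) n ≡⟨ cong (H xor_) (evalAt-insert x y m P n) ⟩
    H xor (M xor evalAt x y P n)    ≡⟨ sym (xor-assoc H M _) ⟩
    (H xor M) xor evalAt x y P n    ≡⟨ cong (_xor evalAt x y P n) (xor-comm H M) ⟩
    (M xor H) xor evalAt x y P n    ≡⟨ xor-assoc M H _ ⟩
    M xor (H xor evalAt x y P n)    ∎
    where
    open ≡-Reasoning
    M = monomialAt x y m n
    H = monomialAt x y h n

  evalAt-normalize : ∀ x y P → evalAt x y (normalize P) ≗ evalAt x y P
  evalAt-normalize x y []      n = refl
  evalAt-normalize x y (m ∷ P) = ≗-trans (evalAt-insert x y m (normalize P)) (⊕-cong (≗-refl {monomialAt x y m}) (evalAt-normalize x y P))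

  evalAt-normalize-++ : ∀ x y A B → normalize (A ++ B) ≡ [] → evalAt x y A ≗ evalAt x y B
  evalAt-normalize-++ x y A B e = ⊕-cancel (evalAt x y A) (evalAt x y B)
    (≗-trans (≗-sym (evalAt-++ x y A B)) (≗-trans (≗-sym (evalAt-normalize x y (A ++ B))) (λ n → cong (λ L → evalAt x y L n) e)))

  scale : ℕ × ℕ → Poly2 → Poly2
  scale (a , b) []            = []
  scale (a , b) ((c , d) ∷ P) = (a + c , b + d) ∷ scale (a , b) P

  evalAt-scale : ∀ x y a b P → evalAt x y (scale (a , b) P) ≗ monomialAt x y (a , b) ⊛ evalAt x y P
  evalAt-scale x y a b []            = ≗-sym (⊛-zeroʳ (monomialAt x y (a , b)))
  evalAt-scale x y a b ((c , d) ∷ P) =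
    ≗-trans (⊕-cong (monomialAt-+ x y a b c d) (evalAt-scale x y a b P)) (≗-sym (⊛-distribˡ-⊕ (monomialAt x y (a , b)) _ _))

  productTerms : Poly2 → Poly2 → Poly2
  productTerms []      B = []
  productTerms (m ∷ A) B = scale m B ++ productTerms A B

  evalAt-productTerms : ∀ x y A B → evalAt x y (productTerms A B) ≗ evalAt x y A ⊛ evalAt x y B
  evalAt-productTerms x y []      B = ≗-sym (⊛-zeroˡ (evalAt x y B))
  evalAt-productTerms x y (m ∷ A) B = begin
    evalAt x y (scale m B ++ productTerms A B)                          ≈⟨ evalAt-++ x y (scale m B) _ ⟩
    evalAt x y (scale m B) ⊕ evalAt x y (productTerms A B)              ≈⟨ ⊕-cong (evalAt-scale x y _ _ B) (evalAt-productTerms x y A B) ⟩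
    (monomialAt x y m ⊛ evalAt x y B) ⊕ (evalAt x y A ⊛ evalAt x y B)  ≈⟨ ≗-sym (⊛-distribʳ-⊕ (evalAt x y B) (monomialAt x y m) _) ⟩
    evalAt x y (m ∷ A) ⊛ evalAt x y B                                   ∎
    where open ≗-Reasoning

  _*ₚ_ : Poly2 → Poly2 → Poly2
  A *ₚ B = normalize (productTerms A B)

  evalAt-*ₚ : ∀ x y A B → evalAt x y (A *ₚ B) ≗ evalAt x y A ⊛ evalAt x y B
  evalAt-*ₚ x y A B = ≗-trans (evalAt-normalize x y (productTerms A B)) (evalAt-productTerms x y A B)

  _^ₚ_ : Poly2 → ℕ → Poly2
  A ^ₚ zero  = (0 , 0) ∷ []
  A ^ₚ suc k = A *ₚ (A ^ₚ k)

  evalAt-^ₚ : ∀ x y A k → evalAt x y (A ^ₚ k) ≗ evalAt x y A ^PS k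
  evalAt-^ₚ x y A zero    n = trans (xor-identityʳ _) (⊛-identityˡ onePS n)
  evalAt-^ₚ x y A (suc k) = ≗-trans (evalAt-*ₚ x y A (A ^ₚ k)) (⊛-congˡ (evalAt x y A) (evalAt-^ₚ x y A k))

  substVars : Poly2 → Poly2 → Poly2 → Poly2
  substVars X Y []            = []
  substVars X Y ((a , b) ∷ P) = ((X ^ₚ a) *ₚ (Y ^ₚ b)) ++ substVars X Y P

  evalAt-substVars : ∀ x y X Y P → evalAt x y (substVars X Y P) ≗ evalAt (evalAt x y X) (evalAt x y Y) P
  evalAt-substVars x y X Y []            n = refl
  evalAt-substVars x y X Y ((a , b) ∷ P) =
    ≗-trans (evalAt-++ x y ((X ^ₚ a) *ₚ (Y ^ₚ b)) (substVars X Y P))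
      (⊕-cong (≗-trans (evalAt-*ₚ x y (X ^ₚ a) (Y ^ₚ b)) (⊛-cong (evalAt-^ₚ x y X a) (evalAt-^ₚ x y Y b)))
              (evalAt-substVars x y X Y P))

module IntegerResidues where

  open import Data.Bool using (Bool; true; false; _xor_; _∧_; not; T)
  open import Data.Nat as ℕ using (ℕ; zero; suc; _≡ᵇ_; _∸_; z≤n; s≤s; NonZero)
  import Data.Nat.Properties as ℕP
  import Data.Nat.DivMod as ℕD
  open import Data.Integer as ℤ using (ℤ; +_; -[1+_]; _-_; _+_; _*_; -_; ∣_∣; _%ℕ_; _/ℕ_)
  import Data.Integer.Properties as ℤP
  open import Data.Integer.DivMod using (a≡a%ℕn+[a/ℕn]*n; n%ℕd<d)
  open import Data.Integer.Solver using (module +-*-Solver)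
  open import Data.Product using (Σ; _,_; proj₁; proj₂)
  open import Data.Sum using (_⊎_; inj₁; inj₂)
  open import Function.Bundles using (_⇔_; mk⇔)
  open import Relation.Binary.PropositionalEquality
  open +-*-Solver

  module Mod (d : ℕ) .{{_ : NonZero d}} where

    residue-unique : ∀ r1 r2 q1 q2 → r1 ℕ.< d → r2 ℕ.< d → + r1 + q1 * + d ≡ + r2 + q2 * + d → r1 ≡ r2
    residue-unique r1 r2 q1 q2 l1 l2 e = ℕ-residue-unique (ℤP.+-injective
      (trans (sym (lift r1 q1 Q1 e1)) (trans (cong (_+ + (N ℕ.* d)) e) (lift r2 q2 Q2 e2))))
      where
      -- shift both quotients by the same N so that they become natural numbers
      N = ∣ q1 ∣ ℕ.+ ∣ q2 ∣
      nonnegative : ∀ q → ∣ q ∣ ℕ.≤ N → Σ ℕ (λ Q → q + + N ≡ + Q)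
      nonnegative (+ n)    _   = n ℕ.+ N , refl
      nonnegative -[1+ n ] n<N = N ∸ suc n , ℤP.⊖-≥ n<N
      Q1 = proj₁ (nonnegative q1 (ℕP.m≤m+n _ _))
      Q2 = proj₁ (nonnegative q2 (ℕP.m≤n+m _ _))
      e1 = proj₂ (nonnegative q1 (ℕP.m≤m+n _ _))
      e2 = proj₂ (nonnegative q2 (ℕP.m≤n+m _ _))
      lift : ∀ r q Q → q + + N ≡ + Q → + r + q * + d + + (N ℕ.* d) ≡ + (r ℕ.+ Q ℕ.* d)
      lift r q Q e = begin
        + r + q * + d + + (N ℕ.* d) ≡⟨ cong (λ z → + r + q * + d + z) (ℤP.pos-* N d) ⟩
        + r + q * + d + + N * + d   ≡⟨ solve 4 (λ R X Y D → R :+ X :* D :+ Y :* D := R :+ (X :+ Y) :* D) refl (+ r) q (+ N) (+ d) ⟩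
        + r + (q + + N) * + d       ≡⟨ cong (λ z → + r + z * + d) e ⟩
        + r + + Q * + d             ≡⟨ trans (cong (λ z → + r + z) (sym (ℤP.pos-* Q d))) (sym (ℤP.pos-+ r (Q ℕ.* d))) ⟩
        + (r ℕ.+ Q ℕ.* d)           ∎
        where open ≡-Reasoning
      ℕ-residue-unique : r1 ℕ.+ Q1 ℕ.* d ≡ r2 ℕ.+ Q2 ℕ.* d → r1 ≡ r2
      ℕ-residue-unique e = trans (sym (trans (ℕD.[m+kn]%n≡m%n r1 Q1 d) (ℕD.m<n⇒m%n≡m l1)))
        (trans (cong (ℕ._% d) e) (trans (ℕD.[m+kn]%n≡m%n r2 Q2 d) (ℕD.m<n⇒m%n≡m l2)))

    %ℕ-unique : ∀ x r q → r ℕ.< d → x ≡ + r + q * + d → x %ℕ d ≡ r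
    %ℕ-unique x r q l e = residue-unique (x %ℕ d) r (x /ℕ d) q (n%ℕd<d x d) l (trans (sym (a≡a%ℕn+[a/ℕn]*n x d)) e)

    %ℕ-+-multiple : ∀ x q → (x + q * + d) %ℕ d ≡ x %ℕ d
    %ℕ-+-multiple x q = %ℕ-unique (x + q * + d) (x %ℕ d) (x /ℕ d + q) (n%ℕd<d x d)
      (trans (cong (λ z → z + q * + d) (a≡a%ℕn+[a/ℕn]*n x d))
        (solve 4 (λ R A Q D → R :+ A :* D :+ Q :* D := R :+ (A :+ Q) :* D) refl (+ (x %ℕ d)) (x /ℕ d) q (+ d)))

    %ℕ-respects-residue₁ : (e : ℤ → ℤ) (w : ℤ → ℤ → ℤ) → (∀ R Q → e (R + Q * + d) ≡ e R + w R Q * + d) →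
              ∀ a → e a %ℕ d ≡ e (+ (a %ℕ d)) %ℕ d
    %ℕ-respects-residue₁ e w h a = trans (cong (λ z → e z %ℕ d) (a≡a%ℕn+[a/ℕn]*n a d))
      (trans (cong (_%ℕ d) (h (+ (a %ℕ d)) (a /ℕ d))) (%ℕ-+-multiple (e (+ (a %ℕ d))) (w (+ (a %ℕ d)) (a /ℕ d))))

    %ℕ-respects-residue₂ : (e : ℤ → ℤ → ℤ) (w : ℤ → ℤ → ℤ → ℤ → ℤ) →
              (∀ R Q S T → e (R + Q * + d) (S + T * + d) ≡ e R S + w R Q S T * + d) →
              ∀ a b → e a b %ℕ d ≡ e (+ (a %ℕ d)) (+ (b %ℕ d)) %ℕ d
    %ℕ-respects-residue₂ e w h a b = trans (cong₂ (λ z y → e z y %ℕ d) (a≡a%ℕn+[a/ℕn]*n a d) (a≡a%ℕn+[a/ℕn]*n b d))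
      (trans (cong (_%ℕ d) (h (+ (a %ℕ d)) (a /ℕ d) (+ (b %ℕ d)) (b /ℕ d)))
        (%ℕ-+-multiple (e (+ (a %ℕ d)) (+ (b %ℕ d))) (w (+ (a %ℕ d)) (a /ℕ d) (+ (b %ℕ d)) (b /ℕ d))))

    -+-%ℕ≡0⇔ : ∀ k m → ((+ k - + m) %ℕ d ≡ 0) ⇔ (k ℕ.% d ≡ m ℕ.% d)
    -+-%ℕ≡0⇔ k m = mk⇔ to from
      where
      r₁ = k ℕ.% d
      r₂ = m ℕ.% d
      +-decompose : ∀ n → + n ≡ + (n ℕ.% d) + + (n ℕ./ d) * + d
      +-decompose n = trans (cong +_ (ℕD.m≡m%n+[m/n]*n n d))
        (trans (ℤP.pos-+ (n ℕ.% d) _) (cong (λ t → + (n ℕ.% d) + t) (ℤP.pos-* (n ℕ./ d) d)))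
      reduce : (+ k - + m) %ℕ d ≡ (+ r₁ - + r₂) %ℕ d
      reduce = trans (cong (_%ℕ d) (trans (cong₂ _-_ (+-decompose k) (+-decompose m))
          (solve 5 (λ a b c e D → (a :+ c :* D) :- (b :+ e :* D) := (a :- b) :+ (c :- e) :* D) refl
            (+ r₁) (+ r₂) (+ (k ℕ./ d)) (+ (m ℕ./ d)) (+ d))))
        (%ℕ-+-multiple (+ r₁ - + r₂) (+ (k ℕ./ d) - + (m ℕ./ d)))
      to : (+ k - + m) %ℕ d ≡ 0 → r₁ ≡ r₂
      to e = residue-unique r₁ r₂ (+ 0) (z /ℕ d) (ℕD.m%n<n k d) (ℕD.m%n<n m d) (begin
        + r₁ + + 0 * + d          ≡⟨ solve 2 (λ a b → a :+ con (+ 0) :* con (+ d) := b :+ (a :- b)) refl (+ r₁) (+ r₂) ⟩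
        + r₂ + z                  ≡⟨ cong (λ t → + r₂ + t) (a≡a%ℕn+[a/ℕn]*n z d) ⟩
        + r₂ + (+ (z %ℕ d) + (z /ℕ d) * + d) ≡⟨ cong (λ t → + r₂ + (+ t + (z /ℕ d) * + d)) (trans (sym reduce) e) ⟩
        + r₂ + (+ 0 + (z /ℕ d) * + d)       ≡⟨ cong (λ t → + r₂ + t) (ℤP.+-identityˡ ((z /ℕ d) * + d)) ⟩
        + r₂ + (z /ℕ d) * + d     ∎)
        where
        open ≡-Reasoning
        z = + r₁ - + r₂
      from : r₁ ≡ r₂ → (+ k - + m) %ℕ d ≡ 0
      from r₁≡r₂ = trans reduce (trans (cong (λ t → (+ t - + r₂) %ℕ d) r₁≡r₂)
        (trans (cong (_%ℕ d) (ℤP.+-inverseʳ (+ r₂))) (ℕD.m*n%n≡0 0 d)))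

  cases<5 : ∀ {P : ℕ → Set} → P 0 → P 1 → P 2 → P 3 → P 4 → ∀ r → r ℕ.< 5 → P r
  cases<5 p0 p1 p2 p3 p4 0 _ = p0
  cases<5 p0 p1 p2 p3 p4 1 _ = p1
  cases<5 p0 p1 p2 p3 p4 2 _ = p2
  cases<5 p0 p1 p2 p3 p4 3 _ = p3
  cases<5 p0 p1 p2 p3 p4 4 _ = p4
  cases<5 p0 p1 p2 p3 p4 (suc (suc (suc (suc (suc r))))) (s≤s (s≤s (s≤s (s≤s (s≤s ())))))

  cases<2 : ∀ {P : ℕ → Set} → P 0 → P 1 → ∀ r → r ℕ.< 2 → P r
  cases<2 p0 p1 0 _ = p0
  cases<2 p0 p1 1 _ = p1
  cases<2 p0 p1 (suc (suc r)) (s≤s (s≤s ()))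

  ≡ᵇ-true⇒≡ : ∀ m n → (m ≡ᵇ n) ≡ true → m ≡ n
  ≡ᵇ-true⇒≡ m n e = ℕP.≡ᵇ⇒≡ m n (subst T (sym e) _)

  ≡ᵇ-refl : ∀ n → (n ≡ᵇ n) ≡ true
  ≡ᵇ-refl zero = refl
  ≡ᵇ-refl (suc n) = ≡ᵇ-refl n

  ≡ᵇ-false⇒≢ : ∀ {m n} → (m ≡ᵇ n) ≡ false → m ≢ n
  ≡ᵇ-false⇒≢ {m} e refl with () ← trans (sym e) (≡ᵇ-refl m)

  even⊎odd : ∀ n → Σ ℕ (λ k → (n ≡ k ℕ.+ k) ⊎ (n ≡ suc (k ℕ.+ k)))
  even⊎odd zero = 0 , inj₁ refl
  even⊎odd (suc n) with even⊎odd n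
  ... | k , inj₁ e = k , inj₂ (cong suc e)
  ... | k , inj₂ e = suc k , inj₁ (trans (cong suc e) (cong suc (sym (ℕP.+-suc k k))))

  double-≡ᵇ : ∀ x k → (x ℕ.+ x ≡ᵇ k ℕ.+ k) ≡ (x ≡ᵇ k)
  double-≡ᵇ zero zero = refl
  double-≡ᵇ zero (suc k) = refl
  double-≡ᵇ (suc x) zero = refl
  double-≡ᵇ (suc x) (suc k) rewrite ℕP.+-suc x x | ℕP.+-suc k k = double-≡ᵇ x k

  double-≡ᵇ-odd : ∀ x k → (x ℕ.+ x ≡ᵇ suc (k ℕ.+ k)) ≡ false
  double-≡ᵇ-odd zero k = refl
  double-≡ᵇ-odd (suc x) zero rewrite ℕP.+-suc x x = refl
  double-≡ᵇ-odd (suc x) (suc k) rewrite ℕP.+-suc x x | ℕP.+-suc k k = double-≡ᵇ-odd x k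

  class5 : ℤ → ℤ → Bool
  class5 i a = ((a - i) %ℕ 5 ≡ᵇ 0)

  isEven : ℤ → Bool
  isEven a = (a %ℕ 2 ≡ᵇ 0)

  module M5 = Mod 5
  module M2 = Mod 2

  class5-residue : ∀ j a → class5 j a ≡ class5 j (+ (a %ℕ 5))
  class5-residue j a = cong (_≡ᵇ 0) (M5.%ℕ-respects-residue₁ (λ z → z - j) (λ R Q → Q)
    (solve 3 (λ J R Q → (R :+ Q :* con (+ 5)) :- J := (R :- J) :+ Q :* con (+ 5)) refl j) a)

  class5-transfer : (e : ℤ → ℤ) (i j : ℤ) (w : ℤ → ℤ → ℤ) →
    (∀ R Q → e (R + Q * + 5) - i ≡ (e R - i) + w R Q * + 5) →
    (∀ r → r ℕ.< 5 → class5 i (e (+ r)) ≡ class5 j (+ r)) → ∀ a → class5 i (e a) ≡ class5 j a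
  class5-transfer e i j w h fin a = trans (cong (_≡ᵇ 0) (M5.%ℕ-respects-residue₁ (λ z → e z - i) w h a))
    (trans (fin (a %ℕ 5) (n%ℕd<d a 5)) (sym (class5-residue j a)))

  class5-neg-double₁ : ∀ c → class5 (+ 1) (- (c + c)) ≡ class5 (+ 2) c
  class5-neg-double₁ = class5-transfer (λ c → - (c + c)) (+ 1) (+ 2) (λ R Q → - (Q + Q))
    (solve 2 (λ R Q → (:- ((R :+ Q :* con (+ 5)) :+ (R :+ Q :* con (+ 5)))) :- con (+ 1) := ((:- (R :+ R)) :- con (+ 1)) :+ (:- (Q :+ Q)) :* con (+ 5)) refl)
    (cases<5 {λ r → class5 (+ 1) (- (+ r + + r)) ≡ class5 (+ 2) (+ r)} refl refl refl refl refl)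

  class5-double₂ : ∀ c → class5 (+ 2) (c + c) ≡ class5 (+ 1) c
  class5-double₂ = class5-transfer (λ c → c + c) (+ 2) (+ 1) (λ R Q → Q + Q)
    (solve 2 (λ R Q → ((R :+ Q :* con (+ 5)) :+ (R :+ Q :* con (+ 5))) :- con (+ 2) := ((R :+ R) :- con (+ 2)) :+ (Q :+ Q) :* con (+ 5)) refl)
    (cases<5 {λ r → class5 (+ 2) (+ r + + r) ≡ class5 (+ 1) (+ r)} refl refl refl refl refl)

  class5-double₁ : ∀ c → class5 (+ 1) (c + c) ≡ class5 (+ 3) c
  class5-double₁ = class5-transfer (λ c → c + c) (+ 1) (+ 3) (λ R Q → Q + Q)
    (solve 2 (λ R Q → ((R :+ Q :* con (+ 5)) :+ (R :+ Q :* con (+ 5))) :- con (+ 1) := ((R :+ R) :- con (+ 1)) :+ (Q :+ Q) :* con (+ 5)) refl)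
    (cases<5 {λ r → class5 (+ 1) (+ r + + r) ≡ class5 (+ 3) (+ r)} refl refl refl refl refl)

  class5-neg₂ : ∀ c → class5 (+ 2) (- c) ≡ class5 (+ 3) c
  class5-neg₂ = class5-transfer (λ c → - c) (+ 2) (+ 3) (λ R Q → - Q)
    (solve 2 (λ R Q → (:- (R :+ Q :* con (+ 5))) :- con (+ 2) := ((:- R) :- con (+ 2)) :+ (:- Q) :* con (+ 5)) refl)
    (cases<5 {λ r → class5 (+ 2) (- (+ r)) ≡ class5 (+ 3) (+ r)} refl refl refl refl refl)

  class5-rotation : ∀ a b → (class5 (+ 1) (b - a) ∧ class5 (+ 2) (- a - b)) ≡ (class5 (+ 1) a ∧ class5 (+ 2) b)
  class5-rotation a b = trans (cong₂ (λ x y → (x ≡ᵇ 0) ∧ (y ≡ᵇ 0))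
      (M5.%ℕ-respects-residue₂ (λ a b → (b - a) - + 1) (λ R Q S T → T - Q)
        (solve 4 (λ R Q S T → ((S :+ T :* con (+ 5)) :- (R :+ Q :* con (+ 5))) :- con (+ 1) := ((S :- R) :- con (+ 1)) :+ (T :- Q) :* con (+ 5)) refl) a b)
      (M5.%ℕ-respects-residue₂ (λ a b → (- a - b) - + 2) (λ R Q S T → - Q - T)
        (solve 4 (λ R Q S T → ((:- (R :+ Q :* con (+ 5))) :- (S :+ T :* con (+ 5))) :- con (+ 2) := (((:- R) :- S) :- con (+ 2)) :+ ((:- Q) :- T) :* con (+ 5)) refl) a b))
    (trans (fin (a %ℕ 5) (n%ℕd<d a 5) (b %ℕ 5) (n%ℕd<d b 5)) (sym (cong₂ _∧_ (class5-residue (+ 1) a) (class5-residue (+ 2) b))))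
    where
    P : ℕ → ℕ → Set
    P r s = (class5 (+ 1) (+ s - + r) ∧ class5 (+ 2) (- + r - + s)) ≡ (class5 (+ 1) (+ r) ∧ class5 (+ 2) (+ s))
    fin : ∀ r → r ℕ.< 5 → ∀ s → s ℕ.< 5 → P r s
    fin = cases<5 {λ r → ∀ s → s ℕ.< 5 → P r s}
      (cases<5 {P 0} refl refl refl refl refl) (cases<5 {P 1} refl refl refl refl refl) (cases<5 {P 2} refl refl refl refl refl)
      (cases<5 {P 3} refl refl refl refl refl) (cases<5 {P 4} refl refl refl refl refl)

  half : ℤ → ℤ
  half y = y /ℕ 2

  half-unique : ∀ x q → x ≡ + 0 + q * + 2 → half x ≡ q
  half-unique x q e = ℤP.*-cancelʳ-≡ (half x) q (+ 2)
    (trans (sym (ℤP.+-identityˡ (half x * + 2))) (trans (cong (λ z → + z + half x * + 2) (sym m0)) (trans (sym (a≡a%ℕn+[a/ℕn]*n x 2)) (trans e (ℤP.+-identityˡ (q * + 2))))))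
    where
    m0 : x %ℕ 2 ≡ 0
    m0 = M2.%ℕ-unique x 0 q (s≤s z≤n) e

  half-double : ∀ c → half (c + c) ≡ c
  half-double c = half-unique (c + c) c (solve 1 (λ c → c :+ c := con (+ 0) :+ c :* con (+ 2)) refl c)

  double-half : ∀ y → isEven y ≡ true → half y + half y ≡ y
  double-half y e = sym (trans (a≡a%ℕn+[a/ℕn]*n y 2) (trans (cong (λ z → + z + half y * + 2) (≡ᵇ-true⇒≡ (y %ℕ 2) 0 e))
    (solve 1 (λ h → con (+ 0) :+ h :* con (+ 2) := h :+ h) refl (half y))))

  isEven-residue : ∀ a → isEven a ≡ isEven (+ (a %ℕ 2))
  isEven-residue a = cong (_≡ᵇ 0) (M2.%ℕ-respects-residue₁ (λ z → z) (λ R Q → Q) (λ R Q → refl) a)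

  isEven-+ : ∀ a b → isEven (a + b) ≡ not (isEven a xor isEven b)
  isEven-+ a b = trans (cong (_≡ᵇ 0) (M2.%ℕ-respects-residue₂ (λ a b → a + b) (λ R Q S T → Q + T)
      (solve 4 (λ R Q S T → (R :+ Q :* con (+ 2)) :+ (S :+ T :* con (+ 2)) := (R :+ S) :+ (Q :+ T) :* con (+ 2)) refl) a b))
    (trans (fin (a %ℕ 2) (n%ℕd<d a 2) (b %ℕ 2) (n%ℕd<d b 2)) (sym (cong₂ (λ x y → not (x xor y)) (isEven-residue a) (isEven-residue b))))
    where
    P : ℕ → ℕ → Set
    P r s = isEven (+ r + + s) ≡ not (isEven (+ r) xor isEven (+ s))
    fin : ∀ r → r ℕ.< 2 → ∀ s → s ℕ.< 2 → P r s
    fin = cases<2 {λ r → ∀ s → s ℕ.< 2 → P r s} (cases<2 {P 0} refl refl) (cases<2 {P 1} refl refl)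

  isEven-double : ∀ c → isEven (c + c) ≡ true
  isEven-double c = trans (cong (λ z → z %ℕ 2 ≡ᵇ 0) (solve 1 (λ c → c :+ c := con (+ 0) :+ c :* con (+ 2)) refl c))
    (cong (_≡ᵇ 0) (M2.%ℕ-+-multiple (+ 0) c))

  isEven-neg-double : ∀ c → isEven (- (c + c)) ≡ true
  isEven-neg-double c = trans (cong isEven (solve 1 (λ c → :- (c :+ c) := (:- c) :+ (:- c)) refl c)) (isEven-double (- c))

  neg-half-neg-double : ∀ c → - half (- (c + c)) ≡ c
  neg-half-neg-double c = trans (cong (λ z → - half z) (solve 1 (λ c → :- (c :+ c) := (:- c) :+ (:- c)) refl c))
    (trans (cong -_ (half-double (- c))) (ℤP.neg-involutive c))

  neg-double-neg-half : ∀ y → isEven y ≡ true → - ((- half y) + (- half y)) ≡ y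
  neg-double-neg-half y e = trans (solve 1 (λ h → :- ((:- h) :+ (:- h)) := h :+ h) refl (half y)) (double-half y e)

  ∣double∣ : ∀ c → ∣ c + c ∣ ≡ ∣ c ∣ ℕ.+ ∣ c ∣
  ∣double∣ (+ n) = refl
  ∣double∣ -[1+ n ] = cong suc (sym (ℕP.+-suc n n))

  ∣half∣≤ : ∀ y → isEven y ≡ true → ∣ half y ∣ ℕ.≤ ∣ y ∣
  ∣half∣≤ y e = subst (∣ half y ∣ ℕ.≤_) (trans (sym (∣double∣ (half y))) (cong ∣_∣ (double-half y e))) (ℕP.m≤m+n _ _)

module BallSums where

  open import Data.Bool using (Bool; true; false; _xor_; _∧_)
  open import Data.Nat as ℕ using (ℕ; suc; _∸_; s≤s)
  import Data.Nat.Properties as ℕP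
  open import Data.Integer as ℤ using (ℤ; +_; -[1+_]; _-_; _+_; -_; ∣_∣)
  import Data.Integer.Properties as ℤP
  open import Data.Integer.Solver using (module +-*-Solver)
  open import Data.Product using (Σ; _×_; _,_; proj₁; proj₂)
  open import Function using (id)
  open import Relation.Nullary using (does; yes)
  open import Relation.Nullary.Decidable using (dec-true)
  open import Relation.Binary.PropositionalEquality
  open BoolSums
  open IntegerResidues
  open +-*-Solver

  sumBall : ℕ → (ℤ → Bool) → Bool
  sumBall M h = sumBelow (suc (2 ℕ.* M)) (λ k → h (+ k - + M))

  _=ℤ_ : ℤ → ℤ → Bool
  a =ℤ b = does (a ℤ.≟ b)

  =ℤ-refl : ∀ a → a =ℤ a ≡ true
  =ℤ-refl a = dec-true (a ℤ.≟ a) refl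

  =ℤ⇒≡ : ∀ a b → a =ℤ b ≡ true → a ≡ b
  =ℤ⇒≡ a b e with a ℤ.≟ b
  ... | yes p = p

  sumBall-cong : ∀ M {h g : ℤ → Bool} → (∀ a → h a ≡ g a) → sumBall M h ≡ sumBall M g
  sumBall-cong M e = sumBelow-cong (suc (2 ℕ.* M)) (λ k _ → e (+ k - + M))

  sumBall-xor : ∀ M (h g : ℤ → Bool) → sumBall M (λ a → h a xor g a) ≡ sumBall M h xor sumBall M g
  sumBall-xor M h g = sumBelow-xor (suc (2 ℕ.* M)) (λ k → h (+ k - + M)) (λ k → g (+ k - + M))

  sumBall-zero : ∀ M (h : ℤ → Bool) → (∀ a → h a ≡ false) → sumBall M h ≡ false
  sumBall-zero M h e = sumBelow-zero (suc (2 ℕ.* M)) _ (λ k → e (+ k - + M))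

  sumBall-∧ʳ : ∀ M b (h : ℤ → Bool) → sumBall M h ∧ b ≡ sumBall M (λ a → h a ∧ b)
  sumBall-∧ʳ M b h = sumBelow-∧ʳ (suc (2 ℕ.* M)) b (λ k → h (+ k - + M))

  sumBall-swap : ∀ M N (G : ℤ → ℤ → Bool) → sumBall M (λ a → sumBall N (λ b → G a b)) ≡ sumBall N (λ b → sumBall M (λ a → G a b))
  sumBall-swap M N G = sumBelow-swap (suc (2 ℕ.* M)) (suc (2 ℕ.* N)) (λ i j → G (+ i - + M) (+ j - + N))

  +-−-cancel : ∀ c M → (c + + M) - + M ≡ c
  +-−-cancel c M = solve 2 (λ c m → (c :+ m) :- m := c) refl c (+ M)

  ball-index : ∀ c M → ∣ c ∣ ℕ.≤ M → Σ ℕ (λ k → (+ k - + M ≡ c) × (k ℕ.< suc (2 ℕ.* M)))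
  ball-index (+ n) M le = n ℕ.+ M , +-−-cancel (+ n) M , s≤s bound
    where
    bound : n ℕ.+ M ℕ.≤ 2 ℕ.* M
    bound = subst (n ℕ.+ M ℕ.≤_) (cong (M ℕ.+_) (sym (ℕP.+-identityʳ M))) (ℕP.+-monoˡ-≤ M le)
  ball-index -[1+ n ] M le = M ∸ suc n , trans (cong (_- + M) (sym e1)) (+-−-cancel -[1+ n ] M) , s≤s bound
    where
    e1 : -[1+ n ] + + M ≡ + (M ∸ suc n)
    e1 = ℤP.⊖-≥ le
    bound : M ∸ suc n ℕ.≤ 2 ℕ.* M
    bound = ℕP.≤-trans (ℕP.m∸n≤m M (suc n)) (ℕP.m≤m+n M _)

  ball-index-injective : ∀ k j M → + k - + M ≡ + j - + M → k ≡ j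
  ball-index-injective k j M e = ℤP.+-injective (trans (sym (−-+-cancel (+ k))) (trans (cong (_+ + M) e) (−-+-cancel (+ j))))
    where
    −-+-cancel : ∀ c → (c - + M) + + M ≡ c
    −-+-cancel c = solve 2 (λ c m → (c :- m) :+ m := c) refl c (+ M)

  sumBall-single : ∀ M (h : ℤ → Bool) c → (∀ a → h a ≡ true → (a ≡ c) × (∣ c ∣ ℕ.≤ M)) → sumBall M h ≡ h c
  sumBall-single M h c H with h c in e
  ... | true = trans (sumBelow-single (suc (2 ℕ.* M)) k0 (λ k → h (+ k - + M)) (λ i fi → ball-index-injective i k0 M (trans (proj₁ (H _ fi)) (sym ek))) lt) (trans (cong h ek) e)
    where
    ix = ball-index c M (proj₂ (H c e))
    k0 = proj₁ ix
    ek = proj₁ (proj₂ ix)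
    lt = proj₂ (proj₂ ix)
  ... | false = sumBall-zero M h allf
    where
    allf : ∀ a → h a ≡ false
    allf a with h a in e2
    ... | false = refl
    ... | true = trans (sym e2) (trans (cong h (proj₁ (H a e2))) e)

  sumBall-reindex : ∀ M M2 (K : ℤ → Bool) (P : ℤ → Bool) (φ ψ : ℤ → ℤ) →
    (∀ a → ψ (φ a) ≡ a) → (∀ y → P y ≡ true → φ (ψ y) ≡ y) → (∀ a → P (φ a) ≡ true) →
    (∀ a → K (φ a) ≡ true → ∣ φ a ∣ ℕ.≤ M) → (∀ y → P y ≡ true → K y ≡ true → ∣ ψ y ∣ ℕ.≤ M2) →
    sumBall M2 (λ a → K (φ a)) ≡ sumBall M (λ y → P y ∧ K y)
  sumBall-reindex M M2 K P φ ψ ψφ φψ Pφ B1 B2 = begin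
    sumBall M2 (λ a → K (φ a)) ≡⟨ sumBall-cong M2 (λ a → sym (step1 a)) ⟩
    sumBall M2 (λ a → sumBall M (λ y → y =ℤ φ a ∧ K y)) ≡⟨ sumBall-swap M2 M (λ a y → y =ℤ φ a ∧ K y) ⟩
    sumBall M (λ y → sumBall M2 (λ a → y =ℤ φ a ∧ K y)) ≡⟨ sumBall-cong M step2 ⟩
    sumBall M (λ y → P y ∧ K y) ∎
    where
    open ≡-Reasoning
    step1 : ∀ a → sumBall M (λ y → y =ℤ φ a ∧ K y) ≡ K (φ a)
    step1 a = trans (sumBall-single M (λ y → y =ℤ φ a ∧ K y) (φ a) H) (cong (_∧ K (φ a)) (=ℤ-refl (φ a)))
      where
      H : ∀ y → (y =ℤ φ a ∧ K y) ≡ true → (y ≡ φ a) × (∣ φ a ∣ ℕ.≤ M)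
      H y t with y =ℤ φ a in e1 | K y in e2
      ... | true | true = =ℤ⇒≡ y (φ a) e1 , B1 a (trans (cong K (sym (=ℤ⇒≡ y (φ a) e1))) e2)
    step2 : ∀ y → sumBall M2 (λ a → y =ℤ φ a ∧ K y) ≡ P y ∧ K y
    step2 y = trans (sumBall-single M2 (λ a → y =ℤ φ a ∧ K y) (ψ y) H) val
      where
      H : ∀ a → (y =ℤ φ a ∧ K y) ≡ true → (a ≡ ψ y) × (∣ ψ y ∣ ℕ.≤ M2)
      H a t with y =ℤ φ a in e1 | K y in e2
      ... | true | true = trans (sym (ψφ a)) (cong ψ (sym (=ℤ⇒≡ y (φ a) e1))) ,
                          B2 y (trans (cong P (=ℤ⇒≡ y (φ a) e1)) (Pφ a)) e2
      val : (y =ℤ φ (ψ y) ∧ K y) ≡ P y ∧ K y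
      val with P y in ep
      ... | true = cong (_∧ K y) (trans (cong (y =ℤ_) (φψ y ep)) (=ℤ-refl y))
      ... | false with y =ℤ φ (ψ y) in e3
      ... | false = refl
      ... | true with () ← trans (sym ep) (trans (cong P (=ℤ⇒≡ y (φ (ψ y)) e3)) (Pφ (ψ y)))


  sumBall-witness : ∀ M (h : ℤ → Bool) → sumBall M h ≡ true → Σ ℤ (λ a → h a ≡ true)
  sumBall-witness M h e with sumBelow-witness (suc (2 ℕ.* M)) (λ k → h (+ k - + M)) e
  ... | i , ei = (+ i - + M) , ei

  sumBall² : ℕ → (ℤ → ℤ → Bool) → Bool
  sumBall² m G = sumBall m (λ a → sumBall m (λ b → G a b))

  sumBall²-xor : ∀ m F G → sumBall² m (λ a b → F a b xor G a b) ≡ sumBall² m F xor sumBall² m G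
  sumBall²-xor m F G = trans (sumBall-cong m (λ a → sumBall-xor m (F a) (G a))) (sumBall-xor m (λ a → sumBall m (F a)) (λ a → sumBall m (G a)))

  sumBall²-cong : ∀ m {F G : ℤ → ℤ → Bool} → (∀ a b → F a b ≡ G a b) → sumBall² m F ≡ sumBall² m G
  sumBall²-cong m e = sumBall-cong m (λ a → sumBall-cong m (e a))

  sumBall²-swap : ∀ m F → sumBall² m F ≡ sumBall² m (λ b a → F a b)
  sumBall²-swap m F = sumBall-swap m m F

  sumBall-neg-double : ∀ m (K : ℤ → Bool) → (∀ c → K (- (c + c)) ≡ true → ∣ - (c + c) ∣ ℕ.≤ m) → (∀ y → K y ≡ true → ∣ y ∣ ℕ.≤ m) →
    sumBall m (λ c → K (- (c + c))) ≡ sumBall m (λ y → isEven y ∧ K y)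
  sumBall-neg-double m K B1 B2 = sumBall-reindex m m K isEven (λ c → - (c + c)) (λ y → - half y) neg-half-neg-double neg-double-neg-half isEven-neg-double B1
    (λ y p k → subst (ℕ._≤ m) (sym (ℤP.∣-i∣≡∣i∣ (half y))) (ℕP.≤-trans (∣half∣≤ y p) (B2 y k)))

  sumBall-double : ∀ m (K : ℤ → Bool) → (∀ c → K (c + c) ≡ true → ∣ c + c ∣ ℕ.≤ m) → (∀ y → K y ≡ true → ∣ y ∣ ℕ.≤ m) →
    sumBall m (λ c → K (c + c)) ≡ sumBall m (λ y → isEven y ∧ K y)
  sumBall-double m K B1 B2 = sumBall-reindex m m K isEven (λ c → c + c) half half-double double-half isEven-double B1
    (λ y p k → ℕP.≤-trans (∣half∣≤ y p) (B2 y k))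

  sumBall-neg : ∀ m (K : ℤ → Bool) → (∀ y → K y ≡ true → ∣ y ∣ ℕ.≤ m) →
    sumBall m (λ c → K (- c)) ≡ sumBall m K
  sumBall-neg m K B = sumBall-reindex m m K (λ _ → true) -_ -_ ℤP.neg-involutive (λ y _ → ℤP.neg-involutive y) (λ _ → refl)
    (λ c k → B (- c) k) (λ y _ k → subst (ℕ._≤ m) (sym (ℤP.∣-i∣≡∣i∣ y)) (B y k))

  sumBall-shift : ∀ m a (K : ℤ → Bool) → (∀ b → K (b - a) ≡ true → ∣ b - a ∣ ℕ.≤ m) → (∀ t → K t ≡ true → ∣ t + a ∣ ℕ.≤ m) →
    sumBall m (λ b → K (b - a)) ≡ sumBall m K
  sumBall-shift m a K B1 B2 = sumBall-reindex m m K (λ _ → true) (λ b → b - a) (λ t → t + a)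
    (λ b → solve 2 (λ b a → (b :- a) :+ a := b) refl b a) (λ t _ → solve 2 (λ t a → (t :+ a) :- a := t) refl t a) (λ _ → refl)
    B1 (λ t _ k → B2 t k)

  sumBall-neg-double-sub : ∀ m t (K : ℤ → Bool) → (∀ a → K (- (a + a) - t) ≡ true → ∣ - (a + a) - t ∣ ℕ.≤ m) →
    (∀ y → isEven (t + y) ≡ true → K y ≡ true → ∣ - half (y + t) ∣ ℕ.≤ m) →
    sumBall m (λ a → K (- (a + a) - t)) ≡ sumBall m (λ y → isEven (t + y) ∧ K y)
  sumBall-neg-double-sub m t K B1 B2 = sumBall-reindex m m K (λ y → isEven (t + y)) (λ a → - (a + a) - t) (λ y → - half (y + t))
    ψφ φψ Pφ B1 B2
    where
    ψφ : ∀ a → - half ((- (a + a) - t) + t) ≡ a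
    ψφ a = trans (cong (λ z → - half z) (solve 2 (λ a t → ((:- (a :+ a)) :- t) :+ t := :- (a :+ a)) refl a t)) (neg-half-neg-double a)
    φψ : ∀ y → isEven (t + y) ≡ true → - ((- half (y + t)) + (- half (y + t))) - t ≡ y
    φψ y p = trans (cong (_- t) (neg-double-neg-half (y + t) (trans (cong isEven (ℤP.+-comm y t)) p)))
      (solve 2 (λ y t → (y :+ t) :- t := y) refl y t)
    Pφ : ∀ a → isEven (t + (- (a + a) - t)) ≡ true
    Pφ a = trans (cong isEven (solve 2 (λ t a → t :+ ((:- (a :+ a)) :- t) := (:- a) :+ (:- a)) refl t a)) (isEven-double (- a))


  sumBall-mono : ∀ M M′ (h : ℤ → Bool) → (∀ a → h a ≡ true → ∣ a ∣ ℕ.≤ M) → M ℕ.≤ M′ → sumBall M′ h ≡ sumBall M h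
  sumBall-mono M M′ h bound M≤M′ = sumBall-reindex M M′ h (λ _ → true) id id (λ _ → refl) (λ _ _ → refl) (λ _ → refl)
    bound (λ y _ hy → ℕP.≤-trans (bound y hy) M≤M′)

module QuadraticForms where

  open import Data.Bool using (Bool; true; false; _∧_)
  open import Data.Bool.Properties using (∧-comm; ∧-zeroʳ; ∧-conicalˡ)
  open import Data.Nat as ℕ using (ℕ; zero; suc; _≡ᵇ_; z≤n; s≤s; NonZero)
  import Data.Nat.Properties as ℕP
  open import Data.Integer as ℤ using (ℤ; +_; -[1+_]; _-_; _+_; _*_; -_; ∣_∣; _%ℕ_; _/ℕ_)
  import Data.Integer.Properties as ℤP
  open import Data.Integer.DivMod using (a≡a%ℕn+[a/ℕn]*n; n%ℕd<d)
  open import Data.Integer.Solver using (module +-*-Solver)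
  open import Data.Product using (_,_)
  open import Data.Sum using (inj₁; inj₂)
  open import Relation.Nullary using (does)
  open import Relation.Binary.PropositionalEquality
  open import Defs
  open BoolSums
  open PowerSeries
  open IntegerResidues
  open BallSums
  open +-*-Solver

  ∣_∣² : ℤ → ℕ
  ∣ a ∣² = ∣ a ∣ ℕ.* ∣ a ∣

  *-self≡∣∣² : ∀ a → a * a ≡ + ∣ a ∣²
  *-self≡∣∣² (+ n) = ℤP.+◃n≡+n (n ℕ.* n)
  *-self≡∣∣² -[1+ n ] = refl

  ∣i∣≤∣i∣² : ∀ a → ∣ a ∣ ℕ.≤ ∣ a ∣²
  ∣i∣≤∣i∣² a with ∣ a ∣
  ... | zero = z≤n
  ... | suc k = ℕP.m≤m*n (suc k) (suc k)

  ∣i∣≤-of-∣∣² : ∀ w .{{_ : NonZero w}} a n → (w ℕ.* ∣ a ∣² ≡ᵇ n) ≡ true → ∣ a ∣ ℕ.≤ n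
  ∣i∣≤-of-∣∣² w a n e = ℕP.≤-trans (∣i∣≤∣i∣² a) (subst (∣ a ∣² ℕ.≤_) (≡ᵇ-true⇒≡ _ n e) (ℕP.m≤n*m ∣ a ∣² w))

  cases<8 : ∀ {P : ℕ → Set} → P 0 → P 1 → P 2 → P 3 → P 4 → P 5 → P 6 → P 7 → ∀ r → r ℕ.< 8 → P r
  cases<8 p0 p1 p2 p3 p4 p5 p6 p7 0 _ = p0
  cases<8 p0 p1 p2 p3 p4 p5 p6 p7 1 _ = p1
  cases<8 p0 p1 p2 p3 p4 p5 p6 p7 2 _ = p2
  cases<8 p0 p1 p2 p3 p4 p5 p6 p7 3 _ = p3
  cases<8 p0 p1 p2 p3 p4 p5 p6 p7 4 _ = p4
  cases<8 p0 p1 p2 p3 p4 p5 p6 p7 5 _ = p5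
  cases<8 p0 p1 p2 p3 p4 p5 p6 p7 6 _ = p6
  cases<8 p0 p1 p2 p3 p4 p5 p6 p7 7 _ = p7
  cases<8 p0 p1 p2 p3 p4 p5 p6 p7 (suc (suc (suc (suc (suc (suc (suc (suc r)))))))) (s≤s (s≤s (s≤s (s≤s (s≤s (s≤s (s≤s (s≤s ()))))))))

  odd⇒∣∣²%8≡1 : ∀ a → isEven a ≡ false → ∣ a ∣² ℕ.% 8 ≡ 1
  odd⇒∣∣²%8≡1 a e = trans (cong (_%ℕ 8) (sym (*-self≡∣∣² a)))
    (trans (Mod.%ℕ-respects-residue₁ 8 (λ z → z * z) (λ R Q → R * Q * + 2 + Q * Q * + 8)
       (solve 2 (λ R Q → (R :+ Q :* con (+ 8)) :* (R :+ Q :* con (+ 8)) := R :* R :+ (R :* Q :* con (+ 2) :+ Q :* Q :* con (+ 8)) :* con (+ 8)) refl) a)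
     (fin (a %ℕ 8) (n%ℕd<d a 8) (trans (sym e8) e)))
    where
    e8 : isEven a ≡ isEven (+ (a %ℕ 8))
    e8 = trans (cong (λ z → z %ℕ 2 ≡ᵇ 0) (a≡a%ℕn+[a/ℕn]*n a 8))
           (trans (cong (λ z → z %ℕ 2 ≡ᵇ 0) (solve 2 (λ R Q → R :+ Q :* con (+ 8) := R :+ (Q :* con (+ 4)) :* con (+ 2)) refl (+ (a %ℕ 8)) (a /ℕ 8)))
             (cong (_≡ᵇ 0) (Mod.%ℕ-+-multiple 2 (+ (a %ℕ 8)) ((a /ℕ 8) * + 4))))
    P : ℕ → Set
    P r = isEven (+ r) ≡ false → (+ r * + r) %ℕ 8 ≡ 1
    fin : ∀ r → r ℕ.< 8 → P r
    fin = cases<8 {P} (λ ()) (λ _ → refl) (λ ()) (λ _ → refl) (λ ()) (λ _ → refl) (λ ()) (λ _ → refl)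


  form : ℕ → ℕ → ℤ → ℤ → ℕ
  form w₁ w₂ a b = w₁ ℕ.* ∣ a ∣² ℕ.+ w₂ ℕ.* ∣ b ∣²

  +-scaled-∣∣² : ∀ w a → + (w ℕ.* ∣ a ∣²) ≡ + w * (a * a)
  +-scaled-∣∣² w a = trans (ℤP.pos-* w ∣ a ∣²) (cong (+ w *_) (sym (*-self≡∣∣² a)))

  form-from-ℤ : ∀ w₁ a w₂ b v₁ c v₂ d →
    + w₁ * (a * a) + + w₂ * (b * b) ≡ + v₁ * (c * c) + + v₂ * (d * d) → form w₁ w₂ a b ≡ form v₁ v₂ c d
  form-from-ℤ w₁ a w₂ b v₁ c v₂ d e = ℤP.+-injective (begin
    + form w₁ w₂ a b                    ≡⟨ ℤP.pos-+ (w₁ ℕ.* ∣ a ∣²) _ ⟩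
    + (w₁ ℕ.* ∣ a ∣²) + + (w₂ ℕ.* ∣ b ∣²) ≡⟨ cong₂ _+_ (+-scaled-∣∣² w₁ a) (+-scaled-∣∣² w₂ b) ⟩
    + w₁ * (a * a) + + w₂ * (b * b)     ≡⟨ e ⟩
    + v₁ * (c * c) + + v₂ * (d * d)     ≡⟨ sym (cong₂ _+_ (+-scaled-∣∣² v₁ c) (+-scaled-∣∣² v₂ d)) ⟩
    + (v₁ ℕ.* ∣ c ∣²) + + (v₂ ℕ.* ∣ d ∣²) ≡⟨ sym (ℤP.pos-+ (v₁ ℕ.* ∣ c ∣²) _) ⟩
    + form v₁ v₂ c d                    ∎)
    where open ≡-Reasoning

  form-rotate : ∀ a b → form 1 1 (b - a) (- a - b) ≡ form 2 2 a b
  form-rotate a b = form-from-ℤ 1 (b - a) 1 (- a - b) 2 a 2 b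
    (solve 2 (λ a b → con (+ 1) :* ((b :- a) :* (b :- a)) :+ con (+ 1) :* (((:- a) :- b) :* ((:- a) :- b))
                   := con (+ 2) :* (a :* a) :+ con (+ 2) :* (b :* b)) refl a b)

  form-rotate-inverse : ∀ t a → form 1 1 t (- (a + a) - t) ≡ form 2 2 (t + a) a
  form-rotate-inverse t a = form-from-ℤ 1 t 1 (- (a + a) - t) 2 (t + a) 2 a
    (solve 2 (λ t a → con (+ 1) :* (t :* t) :+ con (+ 1) :* (((:- (a :+ a)) :- t) :* ((:- (a :+ a)) :- t))
                   := con (+ 2) :* ((t :+ a) :* (t :+ a)) :+ con (+ 2) :* (a :* a)) refl t a)

  form-neg-doubleˡ : ∀ c b → form 1 1 (- (c + c)) b ≡ form 4 1 c b
  form-neg-doubleˡ c b = form-from-ℤ 1 (- (c + c)) 1 b 4 c 1 b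
    (solve 2 (λ c b → con (+ 1) :* ((:- (c :+ c)) :* (:- (c :+ c))) :+ con (+ 1) :* (b :* b)
                   := con (+ 4) :* (c :* c) :+ con (+ 1) :* (b :* b)) refl c b)

  form-doubleʳ : ∀ a c → form 1 1 a (c + c) ≡ form 4 1 c a
  form-doubleʳ a c = form-from-ℤ 1 a 1 (c + c) 4 c 1 a
    (solve 2 (λ a c → con (+ 1) :* (a :* a) :+ con (+ 1) :* ((c :+ c) :* (c :+ c))
                   := con (+ 4) :* (c :* c) :+ con (+ 1) :* (a :* a)) refl a c)

  form-doubleʳ′ : ∀ a d → form 4 1 a (d + d) ≡ form 4 4 a d
  form-doubleʳ′ a d = form-from-ℤ 4 a 1 (d + d) 4 a 4 d
    (solve 2 (λ a d → con (+ 4) :* (a :* a) :+ con (+ 1) :* ((d :+ d) :* (d :+ d))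
                   := con (+ 4) :* (a :* a) :+ con (+ 4) :* (d :* d)) refl a d)

  form-neg-swap : ∀ a d → form 4 4 (- d) a ≡ form 4 4 a d
  form-neg-swap a d = form-from-ℤ 4 (- d) 4 a 4 a 4 d
    (solve 2 (λ a d → con (+ 4) :* ((:- d) :* (:- d)) :+ con (+ 4) :* (a :* a)
                   := con (+ 4) :* (a :* a) :+ con (+ 4) :* (d :* d)) refl a d)

  ∣double∣² : ∀ c → 1 ℕ.* ∣ c + c ∣² ≡ 4 ℕ.* ∣ c ∣²
  ∣double∣² c = ℤP.+-injective (trans (+-scaled-∣∣² 1 (c + c))
    (trans (solve 1 (λ c → con (+ 1) :* ((c :+ c) :* (c :+ c)) := con (+ 4) :* (c :* c)) refl c) (sym (+-scaled-∣∣² 4 c))))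

  form-boundˡ : ∀ w₁ w₂ .{{_ : NonZero w₁}} a b m → (form w₁ w₂ a b ≡ᵇ m) ≡ true → ∣ a ∣ ℕ.≤ m
  form-boundˡ w₁ w₂ a b m e = ℕP.≤-trans (∣i∣≤∣i∣² a) (subst (∣ a ∣² ℕ.≤_) (≡ᵇ-true⇒≡ _ m e)
    (ℕP.≤-trans (ℕP.m≤n*m ∣ a ∣² w₁) (ℕP.m≤m+n _ (w₂ ℕ.* ∣ b ∣²))))

  form-boundʳ : ∀ w₁ w₂ .{{_ : NonZero w₂}} a b m → (form w₁ w₂ a b ≡ᵇ m) ≡ true → ∣ b ∣ ℕ.≤ m
  form-boundʳ w₁ w₂ a b m e = ℕP.≤-trans (∣i∣≤∣i∣² b) (subst (∣ b ∣² ℕ.≤_) (≡ᵇ-true⇒≡ _ m e)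
    (ℕP.≤-trans (ℕP.m≤n*m ∣ b ∣² w₂) (ℕP.m≤n+m _ (w₁ ℕ.* ∣ a ∣²))))

  -- θ w κ = Σ x^{w a²} over the a ∈ ℤ with κ a; only ∣ a ∣ ≤ n can contribute to xⁿ.
  theta : ℕ → (ℤ → Bool) → PS
  theta w κ n = sumBall n (λ a → (w ℕ.* ∣ a ∣² ≡ᵇ n) ∧ κ a)

  theta-mono : ∀ w .{{_ : NonZero w}} κ i M → i ℕ.≤ M → theta w κ i ≡ sumBall M (λ a → (w ℕ.* ∣ a ∣² ≡ᵇ i) ∧ κ a)
  theta-mono w κ i M i≤M = sym (sumBall-mono i M _
    (λ a e → ∣i∣≤-of-∣∣² w a i (∧-conicalˡ _ (κ a) e)) i≤M)

  theta-⊛ : ∀ w₁ w₂ .{{_ : NonZero w₁}} .{{_ : NonZero w₂}} κ₁ κ₂ m →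
    (theta w₁ κ₁ ⊛ theta w₂ κ₂) m ≡ sumBall² m (λ a b → (form w₁ w₂ a b ≡ᵇ m) ∧ (κ₁ a ∧ κ₂ b))
  theta-⊛ w₁ w₂ κ₁ κ₂ m = begin
    (theta w₁ κ₁ ⊛ theta w₂ κ₂) m
      ≡⟨ ⊛-antidiagonal (theta w₁ κ₁) (theta w₂ κ₂) m ⟩
    sumAntidiagonal m (λ i j → theta w₁ κ₁ i ∧ theta w₂ κ₂ j)
      ≡⟨ sumAntidiagonal-cong m expand ⟩
    sumAntidiagonal m (λ i j → sumBall m (λ a → sumBall m (λ b → A i a ∧ B j b)))
      ≡⟨ sumAntidiagonal-sumBelow m N (λ k i j → sumBall m (λ b → A i (+ k - + m) ∧ B j b)) ⟩
    sumBall m (λ a → sumAntidiagonal m (λ i j → sumBall m (λ b → A i a ∧ B j b)))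
      ≡⟨ sumBall-cong m (λ a → sumAntidiagonal-sumBelow m N (λ k i j → A i a ∧ B j (+ k - + m))) ⟩
    sumBall m (λ a → sumBall m (λ b → sumAntidiagonal m (λ i j → A i a ∧ B j b)))
      ≡⟨ sumBall²-cong m collapse ⟩
    sumBall² m (λ a b → (form w₁ w₂ a b ≡ᵇ m) ∧ (κ₁ a ∧ κ₂ b)) ∎
    where
    open ≡-Reasoning
    N = suc (2 ℕ.* m)
    A : ℕ → ℤ → Bool
    A i a = (w₁ ℕ.* ∣ a ∣² ≡ᵇ i) ∧ κ₁ a
    B : ℕ → ℤ → Bool
    B j b = (w₂ ℕ.* ∣ b ∣² ≡ᵇ j) ∧ κ₂ b
    expand : ∀ i j → i ℕ.+ j ≡ m → (theta w₁ κ₁ i ∧ theta w₂ κ₂ j) ≡ sumBall m (λ a → sumBall m (λ b → A i a ∧ B j b))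
    expand i j i+j≡m = begin
      theta w₁ κ₁ i ∧ theta w₂ κ₂ j
        ≡⟨ cong₂ _∧_ (theta-mono w₁ κ₁ i m (subst (i ℕ.≤_) i+j≡m (ℕP.m≤m+n i j)))
                     (theta-mono w₂ κ₂ j m (subst (j ℕ.≤_) i+j≡m (ℕP.m≤n+m j i))) ⟩
      sumBall m (A i) ∧ sumBall m (B j)
        ≡⟨ sumBall-∧ʳ m (sumBall m (B j)) (A i) ⟩
      sumBall m (λ a → A i a ∧ sumBall m (B j))
        ≡⟨ sumBall-cong m (λ a → trans (∧-comm (A i a) _) (trans (sumBall-∧ʳ m (A i a) (B j))
                                    (sumBall-cong m (λ b → ∧-comm (B j b) (A i a))))) ⟩
      sumBall m (λ a → sumBall m (λ b → A i a ∧ B j b)) ∎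
    rearrange : ∀ x p y q → (x ∧ p) ∧ (y ∧ q) ≡ (p ∧ q) ∧ (x ∧ y)
    rearrange false p y q = sym (∧-zeroʳ (p ∧ q))
    rearrange true false y q = refl
    rearrange true true false q = sym (∧-zeroʳ q)
    rearrange true true true false = refl
    rearrange true true true true = refl
    collapse : ∀ a b → sumAntidiagonal m (λ i j → A i a ∧ B j b) ≡ (form w₁ w₂ a b ≡ᵇ m) ∧ (κ₁ a ∧ κ₂ b)
    collapse a b = begin
      sumAntidiagonal m (λ i j → A i a ∧ B j b)
        ≡⟨ sumAntidiagonal-cong m (λ i j _ → rearrange (w₁ ℕ.* ∣ a ∣² ≡ᵇ i) (κ₁ a) (w₂ ℕ.* ∣ b ∣² ≡ᵇ j) (κ₂ b)) ⟩
      sumAntidiagonal m (λ i j → (κ₁ a ∧ κ₂ b) ∧ ((w₁ ℕ.* ∣ a ∣² ≡ᵇ i) ∧ (w₂ ℕ.* ∣ b ∣² ≡ᵇ j)))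
        ≡⟨ sym (sumAntidiagonal-∧ˡ m (κ₁ a ∧ κ₂ b) _) ⟩
      (κ₁ a ∧ κ₂ b) ∧ sumAntidiagonal m (λ i j → (w₁ ℕ.* ∣ a ∣² ≡ᵇ i) ∧ (w₂ ℕ.* ∣ b ∣² ≡ᵇ j))
        ≡⟨ cong ((κ₁ a ∧ κ₂ b) ∧_) (sumAntidiagonal-indicator m (w₁ ℕ.* ∣ a ∣²) (w₂ ℕ.* ∣ b ∣²)) ⟩
      (κ₁ a ∧ κ₂ b) ∧ (form w₁ w₂ a b ≡ᵇ m)
        ≡⟨ ∧-comm (κ₁ a ∧ κ₂ b) _ ⟩
      (form w₁ w₂ a b ≡ᵇ m) ∧ (κ₁ a ∧ κ₂ b) ∎

  theta-substX² : ∀ w .{{_ : NonZero w}} κ → substX² (theta w κ) ≗ theta (w ℕ.+ w) κ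
  theta-substX² w κ n with even⊎odd n
  ... | k , inj₁ refl = trans (substX²-even (theta w κ) k)
    (trans (theta-mono w κ k (k ℕ.+ k) (ℕP.m≤m+n k k))
    (sumBall-cong (k ℕ.+ k) (λ a → cong (_∧ κ a)
      (trans (sym (double-≡ᵇ (w ℕ.* ∣ a ∣²) k)) (cong (_≡ᵇ k ℕ.+ k) (sym (ℕP.*-distribʳ-+ ∣ a ∣² w w)))))))
  ... | k , inj₂ refl = trans (substX²-odd (theta w κ) k)
    (sym (sumBall-zero (suc (k ℕ.+ k)) _ (λ a → cong (_∧ κ a)
      (trans (cong (_≡ᵇ suc (k ℕ.+ k)) (ℕP.*-distribʳ-+ ∣ a ∣² w w)) (double-≡ᵇ-odd (w ℕ.* ∣ a ∣²) k)))))

  bracket≗theta : ∀ i → bracket i ≗ theta 1 (class5 i)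
  bracket≗theta i m = trans (xorSum-upTo (λ k → does (((+ k - + m) * (+ k - + m)) ℤ.≟ + m) ∧ class5 i (+ k - + m)) (suc (2 ℕ.* m)))
    (sumBelow-cong (suc (2 ℕ.* m)) (λ k _ → cong (_∧ class5 i (+ k - + m)) (square≡ᵇ (+ k - + m))))
    where
    square≡ᵇ : ∀ a → does ((a * a) ℤ.≟ (+ m)) ≡ (1 ℕ.* ∣ a ∣² ≡ᵇ m)
    square≡ᵇ a rewrite *-self≡∣∣² a | ℕP.+-identityʳ ∣ a ∣² = refl

module QuinticRelation where

  open import Data.Bool using (Bool; true; false; _xor_; _∧_; not)
  open import Data.Bool.Properties using (∧-comm; ∧-identityʳ; ∧-zeroʳ; ∧-conicalˡ)
  open import Data.Nat as ℕ using (ℕ; _≡ᵇ_)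
  open import Data.Integer as ℤ using (ℤ; +_; _-_; _+_; -_; ∣_∣)
  import Data.Integer.Properties as ℤP
  open import Data.Integer.Solver using (module +-*-Solver)
  open import Data.List using ([]; _∷_)
  open import Data.Product using (_,_)
  open import Relation.Binary.PropositionalEquality
  open import Defs
  open PowerSeries
  open Polynomials
  open IntegerResidues
  open BallSums
  open QuadraticForms
  open +-*-Solver

  -- The coefficient of xᵐ in each of u⁵, v⁵, uv, u²v² counts (mod 2) the representations of m by
  -- a binary quadratic form with residue conditions mod 5; the four counts are matched up by
  -- explicit changes of variables.
  module Coefficient (m : ℕ) where
    c₁ c₂ c₃ : ℤ → Bool
    c₁ = class5 (+ 1)
    c₂ = class5 (+ 2)
    c₃ = class5 (+ 3)

    termUV termU²V² termU⁵ termV⁵ termUV-even : ℤ → ℤ → Bool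
    termUV a b = (form 1 1 a b ≡ᵇ m) ∧ (c₁ a ∧ c₂ b)
    termU²V² a b = (form 2 2 a b ≡ᵇ m) ∧ (c₁ a ∧ c₂ b)
    termU⁵ a b = (form 4 1 a b ≡ᵇ m) ∧ (c₁ a ∧ c₁ b)
    termV⁵ a b = (form 4 1 a b ≡ᵇ m) ∧ (c₂ a ∧ c₂ b)
    termUV-even a b = termUV a b ∧ isEven (a + b)

    UV-even UV-evenOdd UV-oddEven U⁵-odd U⁵-even V⁵-odd V⁵-even : Bool
    UV-even = sumBall² m termUV-even
    UV-evenOdd = sumBall² m (λ a b → termUV a b ∧ (isEven a ∧ not (isEven b)))
    UV-oddEven = sumBall² m (λ a b → termUV a b ∧ (not (isEven a) ∧ isEven b))
    U⁵-odd = sumBall² m (λ a b → termU⁵ a b ∧ not (isEven b))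
    U⁵-even = sumBall² m (λ a b → termU⁵ a b ∧ isEven b)
    V⁵-odd = sumBall² m (λ a b → termV⁵ a b ∧ not (isEven b))
    V⁵-even = sumBall² m (λ a b → termV⁵ a b ∧ isEven b)

    termU²V²-rotate : ∀ a b → termU²V² a b ≡ termUV-even (b - a) (- (a + a) - (b - a))
    termU²V²-rotate a b = sym (begin
      termUV-even (b - a) (- (a + a) - (b - a))
        ≡⟨ cong (termUV-even (b - a)) (solve 2 (λ a b → (:- (a :+ a)) :- (b :- a) := (:- a) :- b) refl a b) ⟩
      termUV (b - a) (- a - b) ∧ isEven ((b - a) + (- a - b))
        ≡⟨ cong₂ _∧_ (cong₂ _∧_ (cong (_≡ᵇ m) (form-rotate a b)) (class5-rotation a b))
                     (trans (cong isEven (solve 2 (λ a b → (b :- a) :+ ((:- a) :- b) := :- (a :+ a)) refl a b))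
                            (isEven-neg-double a)) ⟩
      termU²V² a b ∧ true
        ≡⟨ ∧-identityʳ (termU²V² a b) ⟩
      termU²V² a b ∎)
      where open ≡-Reasoning

    u²v²≡uv-even : sumBall² m termU²V² ≡ UV-even
    u²v²≡uv-even = begin
      sumBall² m termU²V²
        ≡⟨ sumBall²-cong m termU²V²-rotate ⟩
      sumBall m (λ a → sumBall m (λ b → termUV-even (b - a) (- (a + a) - (b - a))))
        ≡⟨ sumBall-cong m (λ a → sumBall-shift m a (λ s → termUV-even s (- (a + a) - s)) (shift-bound a) (shift-bound⁻¹ a)) ⟩
      sumBall m (λ a → sumBall m (λ t → termUV-even t (- (a + a) - t)))
        ≡⟨ sumBall-swap m m (λ a t → termUV-even t (- (a + a) - t)) ⟩
      sumBall m (λ t → sumBall m (λ a → termUV-even t (- (a + a) - t)))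
        ≡⟨ sumBall-cong m (λ t → sumBall-neg-double-sub m t (termUV-even t) (affine-bound t) (affine-bound⁻¹ t)) ⟩
      sumBall m (λ t → sumBall m (λ y → isEven (t + y) ∧ termUV-even t y))
        ≡⟨ sumBall-cong m (λ t → sumBall-cong m (λ y → ∧-absorb (isEven (t + y)) (termUV t y))) ⟩
      UV-even ∎
      where
      open ≡-Reasoning
      ∧-absorb : ∀ p x → (p ∧ (x ∧ p)) ≡ (x ∧ p)
      ∧-absorb false x = sym (∧-zeroʳ x)
      ∧-absorb true  x = refl
      form-of : ∀ x y → termUV-even x y ≡ true → (form 1 1 x y ≡ᵇ m) ≡ true
      form-of x y k = ∧-conicalˡ _ _ (∧-conicalˡ _ _ k)
      shift-bound : ∀ a b → termUV-even (b - a) (- (a + a) - (b - a)) ≡ true → ∣ b - a ∣ ℕ.≤ m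
      shift-bound a b k = form-boundˡ 1 1 (b - a) (- (a + a) - (b - a)) m (form-of (b - a) (- (a + a) - (b - a)) k)
      shift-bound⁻¹ : ∀ a t → termUV-even t (- (a + a) - t) ≡ true → ∣ t + a ∣ ℕ.≤ m
      shift-bound⁻¹ a t k = form-boundˡ 2 2 (t + a) a m (trans (cong (_≡ᵇ m) (sym (form-rotate-inverse t a))) (form-of t (- (a + a) - t) k))
      affine-bound : ∀ t a → termUV-even t (- (a + a) - t) ≡ true → ∣ - (a + a) - t ∣ ℕ.≤ m
      affine-bound t a k = form-boundʳ 1 1 t (- (a + a) - t) m (form-of t (- (a + a) - t) k)
      affine-bound⁻¹ : ∀ t y → isEven (t + y) ≡ true → termUV-even t y ≡ true → ∣ - half (y + t) ∣ ℕ.≤ m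
      affine-bound⁻¹ t y even k = form-boundʳ 2 2 (t + c) c m
        (trans (cong (_≡ᵇ m) (sym (form-rotate-inverse t c))) (trans (cong (λ z → form 1 1 t z ≡ᵇ m) y≡) (form-of t y k)))
        where
        c = - half (y + t)
        y≡ : - (c + c) - t ≡ y
        y≡ = trans (cong (_- t) (neg-double-neg-half (y + t) (trans (cong isEven (ℤP.+-comm y t)) even)))
                   (solve 2 (λ y t → (y :+ t) :- t := y) refl y t)

    uv-evenOdd≡v⁵-odd : UV-evenOdd ≡ V⁵-odd
    uv-evenOdd≡v⁵-odd = begin
      sumBall² m (λ a b → termUV a b ∧ (isEven a ∧ not (isEven b)))
        ≡⟨ sumBall²-swap m (λ a b → termUV a b ∧ (isEven a ∧ not (isEven b))) ⟩
      sumBall m (λ b → sumBall m (λ a → termUV a b ∧ (isEven a ∧ not (isEven b))))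
        ≡⟨ sumBall-cong m (λ b → sumBall-cong m (λ a → ∧-rotate (termUV a b) (isEven a) (not (isEven b)))) ⟩
      sumBall m (λ b → sumBall m (λ a → isEven a ∧ K b a))
        ≡⟨ sumBall-cong m (λ b → sym (sumBall-neg-double m (K b) (image-bound b) (bound b))) ⟩
      sumBall m (λ b → sumBall m (λ c → K b (- (c + c))))
        ≡⟨ sumBall-cong m (λ b → sumBall-cong m (λ c → cong (_∧ not (isEven b)) (substitute c b))) ⟩
      sumBall m (λ b → sumBall m (λ c → termV⁵ c b ∧ not (isEven b)))
        ≡⟨ sym (sumBall²-swap m (λ c b → termV⁵ c b ∧ not (isEven b))) ⟩
      V⁵-odd ∎
      where
      open ≡-Reasoning
      ∧-rotate : ∀ x p q → (x ∧ (p ∧ q)) ≡ (p ∧ (x ∧ q))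
      ∧-rotate false p q = sym (∧-zeroʳ p)
      ∧-rotate true  p q = refl
      K : ℤ → ℤ → Bool
      K b a = termUV a b ∧ not (isEven b)
      image-bound : ∀ b c → K b (- (c + c)) ≡ true → ∣ - (c + c) ∣ ℕ.≤ m
      image-bound b c k = form-boundˡ 1 1 (- (c + c)) b m (∧-conicalˡ _ _ (∧-conicalˡ _ _ k))
      bound : ∀ b y → K b y ≡ true → ∣ y ∣ ℕ.≤ m
      bound b y k = form-boundˡ 1 1 y b m (∧-conicalˡ _ _ (∧-conicalˡ _ _ k))
      substitute : ∀ c b → termUV (- (c + c)) b ≡ termV⁵ c b
      substitute c b = cong₂ _∧_ (cong (_≡ᵇ m) (form-neg-doubleˡ c b)) (cong (_∧ c₂ b) (class5-neg-double₁ c))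

    uv-oddEven≡u⁵-odd : UV-oddEven ≡ U⁵-odd
    uv-oddEven≡u⁵-odd = begin
      sumBall² m (λ a b → termUV a b ∧ (not (isEven a) ∧ isEven b))
        ≡⟨ sumBall²-cong m (λ a b → ∧-rotate (termUV a b) (not (isEven a)) (isEven b)) ⟩
      sumBall m (λ a → sumBall m (λ b → isEven b ∧ K a b))
        ≡⟨ sumBall-cong m (λ a → sym (sumBall-double m (K a) (image-bound a) (bound a))) ⟩
      sumBall m (λ a → sumBall m (λ c → K a (c + c)))
        ≡⟨ sumBall²-cong m (λ a c → cong (_∧ not (isEven a)) (substitute a c)) ⟩
      sumBall² m (λ a c → termU⁵ c a ∧ not (isEven a))
        ≡⟨ sumBall²-swap m (λ a c → termU⁵ c a ∧ not (isEven a)) ⟩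
      U⁵-odd ∎
      where
      open ≡-Reasoning
      ∧-rotate : ∀ x q p → (x ∧ (q ∧ p)) ≡ (p ∧ (x ∧ q))
      ∧-rotate false q     p = sym (∧-zeroʳ p)
      ∧-rotate true  false p = sym (∧-zeroʳ p)
      ∧-rotate true  true  p = sym (∧-identityʳ p)
      K : ℤ → ℤ → Bool
      K a b = termUV a b ∧ not (isEven a)
      image-bound : ∀ a c → K a (c + c) ≡ true → ∣ c + c ∣ ℕ.≤ m
      image-bound a c k = form-boundʳ 1 1 a (c + c) m (∧-conicalˡ _ _ (∧-conicalˡ _ _ k))
      bound : ∀ a y → K a y ≡ true → ∣ y ∣ ℕ.≤ m
      bound a y k = form-boundʳ 1 1 a y m (∧-conicalˡ _ _ (∧-conicalˡ _ _ k))
      substitute : ∀ a c → termUV a (c + c) ≡ termU⁵ c a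
      substitute a c = cong₂ _∧_ (cong (_≡ᵇ m) (form-doubleʳ a c)) (trans (cong (c₁ a ∧_) (class5-double₂ c)) (∧-comm (c₁ a) (c₁ c)))

    u⁵-even≡v⁵-even : U⁵-even ≡ V⁵-even
    u⁵-even≡v⁵-even = begin
      U⁵-even
        ≡⟨ even-second termU⁵ (λ a d k → form-boundʳ 4 1 a (d + d) m (∧-conicalˡ _ _ k)) (λ a y k → form-boundʳ 4 1 a y m (∧-conicalˡ _ _ k)) ⟩
      sumBall m (λ a → sumBall m (λ d → termU⁵ a (d + d)))
        ≡⟨ sumBall²-cong m (λ a d → cong₂ _∧_ (cong (_≡ᵇ m) (form-doubleʳ′ a d)) (cong (c₁ a ∧_) (class5-double₁ d))) ⟩
      sumBall² m (λ a d → (form 4 4 a d ≡ᵇ m) ∧ (c₁ a ∧ c₃ d))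
        ≡⟨ sumBall²-cong m (λ a d → sym (cong₂ _∧_ (cong (_≡ᵇ m) (form-neg-swap a d)) (trans (cong (_∧ c₁ a) (class5-neg₂ d)) (∧-comm (c₃ d) (c₁ a))))) ⟩
      sumBall m (λ a → sumBall m (λ d → term₄₄ (- d) a))
        ≡⟨ sumBall²-swap m (λ a d → term₄₄ (- d) a) ⟩
      sumBall m (λ d → sumBall m (λ a → term₄₄ (- d) a))
        ≡⟨ sumBall-neg m (λ e → sumBall m (term₄₄ e)) bound ⟩
      sumBall² m term₄₄
        ≡⟨ sym (sumBall²-cong m (λ a d → cong₂ _∧_ (cong (_≡ᵇ m) (form-doubleʳ′ a d)) (cong (c₂ a ∧_) (class5-double₂ d)))) ⟩
      sumBall m (λ a → sumBall m (λ d → termV⁵ a (d + d)))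
        ≡⟨ sym (even-second termV⁵ (λ a d k → form-boundʳ 4 1 a (d + d) m (∧-conicalˡ _ _ k)) (λ a y k → form-boundʳ 4 1 a y m (∧-conicalˡ _ _ k))) ⟩
      V⁵-even ∎
      where
      open ≡-Reasoning
      term₄₄ : ℤ → ℤ → Bool
      term₄₄ a d = (form 4 4 a d ≡ᵇ m) ∧ (c₂ a ∧ c₁ d)
      even-second : ∀ (g : ℤ → ℤ → Bool) → (∀ a d → g a (d + d) ≡ true → ∣ d + d ∣ ℕ.≤ m) → (∀ a y → g a y ≡ true → ∣ y ∣ ℕ.≤ m) →
        sumBall² m (λ a b → g a b ∧ isEven b) ≡ sumBall m (λ a → sumBall m (λ d → g a (d + d)))
      even-second g image-bound bound = trans (sumBall²-cong m (λ a b → ∧-comm (g a b) (isEven b)))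
        (sumBall-cong m (λ a → sym (sumBall-double m (g a) (image-bound a) (bound a))))
      bound : ∀ y → sumBall m (term₄₄ y) ≡ true → ∣ y ∣ ℕ.≤ m
      bound y k with sumBall-witness m (term₄₄ y) k
      ... | a , ka = form-boundˡ 4 4 y a m (∧-conicalˡ _ _ ka)

    uv-split : sumBall² m termUV ≡ UV-even xor (UV-evenOdd xor UV-oddEven)
    uv-split = trans (sumBall²-cong m (λ a b → trans (split (termUV a b) (isEven a) (isEven b))
                                                     (cong (λ z → (termUV a b ∧ z) xor (evenOdd a b xor oddEven a b)) (sym (isEven-+ a b)))))
      (trans (sumBall²-xor m termUV-even (λ a b → evenOdd a b xor oddEven a b)) (cong (UV-even xor_) (sumBall²-xor m evenOdd oddEven)))
      where
      evenOdd oddEven : ℤ → ℤ → Bool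
      evenOdd a b = termUV a b ∧ (isEven a ∧ not (isEven b))
      oddEven a b = termUV a b ∧ (not (isEven a) ∧ isEven b)
      split : ∀ x p q → x ≡ (x ∧ not (p xor q)) xor ((x ∧ (p ∧ not q)) xor (x ∧ (not p ∧ q)))
      split false p     q     = refl
      split true  false false = refl
      split true  false true  = refl
      split true  true  false = refl
      split true  true  true  = refl

    split-second : ∀ (g : ℤ → ℤ → Bool) →
      sumBall² m g ≡ sumBall² m (λ a b → g a b ∧ not (isEven b)) xor sumBall² m (λ a b → g a b ∧ isEven b)
    split-second g = trans (sumBall²-cong m (λ a b → split (g a b) (isEven b)))
      (sumBall²-xor m (λ a b → g a b ∧ not (isEven b)) (λ a b → g a b ∧ isEven b))
      where
      split : ∀ x q → x ≡ (x ∧ not q) xor (x ∧ q)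
      split false q     = refl
      split true  false = refl
      split true  true  = refl

    coefficient-vanishes : sumBall² m termU⁵ xor (sumBall² m termV⁵ xor (sumBall² m termUV xor (sumBall² m termU²V² xor false))) ≡ false
    coefficient-vanishes = begin
      sumBall² m termU⁵ xor (sumBall² m termV⁵ xor (sumBall² m termUV xor (sumBall² m termU²V² xor false)))
        ≡⟨ cong₂ (λ p q → p xor (q xor (sumBall² m termUV xor (sumBall² m termU²V² xor false)))) (split-second termU⁵) (split-second termV⁵) ⟩
      (U⁵-odd xor U⁵-even) xor ((V⁵-odd xor V⁵-even) xor (sumBall² m termUV xor (sumBall² m termU²V² xor false)))
        ≡⟨ cong₂ (λ p q → (U⁵-odd xor U⁵-even) xor ((V⁵-odd xor V⁵-even) xor (p xor (q xor false)))) uv-split u²v²≡uv-even ⟩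
      (U⁵-odd xor U⁵-even) xor ((V⁵-odd xor V⁵-even) xor ((UV-even xor (UV-evenOdd xor UV-oddEven)) xor (UV-even xor false)))
        ≡⟨ cong₂ (λ p q → (U⁵-odd xor U⁵-even) xor ((V⁵-odd xor V⁵-even) xor ((UV-even xor (p xor q)) xor (UV-even xor false))))
                 uv-evenOdd≡v⁵-odd uv-oddEven≡u⁵-odd ⟩
      (U⁵-odd xor U⁵-even) xor ((V⁵-odd xor V⁵-even) xor ((UV-even xor (V⁵-odd xor U⁵-odd)) xor (UV-even xor false)))
        ≡⟨ cong (λ p → (U⁵-odd xor U⁵-even) xor ((V⁵-odd xor p) xor ((UV-even xor (V⁵-odd xor U⁵-odd)) xor (UV-even xor false))))
                (sym u⁵-even≡v⁵-even) ⟩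
      (U⁵-odd xor U⁵-even) xor ((V⁵-odd xor U⁵-even) xor ((UV-even xor (V⁵-odd xor U⁵-odd)) xor (UV-even xor false)))
        ≡⟨ pairs-cancel U⁵-odd U⁵-even V⁵-odd UV-even ⟩
      false ∎
      where
      open ≡-Reasoning
      pairs-cancel : ∀ a b c h → (a xor b) xor ((c xor b) xor ((h xor (c xor a)) xor (h xor false))) ≡ false
      pairs-cancel false false false false = refl
      pairs-cancel false false false true  = refl
      pairs-cancel false false true  false = refl
      pairs-cancel false false true  true  = refl
      pairs-cancel false true  false false = refl
      pairs-cancel false true  false true  = refl
      pairs-cancel false true  true  false = refl
      pairs-cancel false true  true  true  = refl
      pairs-cancel true  false false false = refl
      pairs-cancel true  false false true  = refl
      pairs-cancel true  false true  false = refl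
      pairs-cancel true  false true  true  = refl
      pairs-cancel true  true  false false = refl
      pairs-cancel true  true  false true  = refl
      pairs-cancel true  true  true  false = refl
      pairs-cancel true  true  true  true  = refl

  theta-^2 : ∀ κ → theta 1 κ ^PS 2 ≗ theta 2 κ
  theta-^2 κ = ≗-trans (^-2 (theta 1 κ)) (theta-substX² 1 κ)

  theta-^4 : ∀ κ → theta 1 κ ^PS 4 ≗ theta 4 κ
  theta-^4 κ = ≗-trans (^-4 (theta 1 κ)) (≗-trans (substX²-cong (theta-substX² 1 κ)) (theta-substX² 2 κ))

  u v : PS
  u = bracket (+ 1)
  v = bracket (+ 2)

  u^4≗theta : u ^PS 4 ≗ theta 4 (class5 (+ 1))
  u^4≗theta = ≗-trans (^-cong 4 (bracket≗theta (+ 1))) (theta-^4 (class5 (+ 1)))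

  v^4≗theta : v ^PS 4 ≗ theta 4 (class5 (+ 2))
  v^4≗theta = ≗-trans (^-cong 4 (bracket≗theta (+ 2))) (theta-^4 (class5 (+ 2)))

  quinticRelation : Poly2
  quinticRelation = (5 , 0) ∷ (0 , 5) ∷ (1 , 1) ∷ (2 , 2) ∷ []

  quinticRelation-holds : evalAt u v quinticRelation ≗ zeroPS
  quinticRelation-holds n = trans (cong₂ _xor_ coeffU⁵ (cong₂ _xor_ coeffV⁵ (cong₂ _xor_ coeffUV (cong (_xor false) coeffU²V²))))
    (Coefficient.coefficient-vanishes n)
    where
    open Coefficient n
    coeffU⁵ : monomialAt u v (5 , 0) n ≡ sumBall² n termU⁵
    coeffU⁵ = begin
      monomialAt u v (5 , 0) n ≡⟨ ⊛-identityʳ (u ^PS 5) n ⟩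
      (u ^PS 5) n             ≡⟨ ^-+ u 4 1 n ⟩
      ((u ^PS 4) ⊛ (u ^PS 1)) n ≡⟨ ⊛-cong u^4≗theta (≗-trans (^-1 u) (bracket≗theta (+ 1))) n ⟩
      (theta 4 c₁ ⊛ theta 1 c₁) n ≡⟨ theta-⊛ 4 1 c₁ c₁ n ⟩
      sumBall² n termU⁵       ∎
      where open ≡-Reasoning
    coeffV⁵ : monomialAt u v (0 , 5) n ≡ sumBall² n termV⁵
    coeffV⁵ = begin
      monomialAt u v (0 , 5) n ≡⟨ ⊛-identityˡ (v ^PS 5) n ⟩
      (v ^PS 5) n             ≡⟨ ^-+ v 4 1 n ⟩
      ((v ^PS 4) ⊛ (v ^PS 1)) n ≡⟨ ⊛-cong v^4≗theta (≗-trans (^-1 v) (bracket≗theta (+ 2))) n ⟩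
      (theta 4 c₂ ⊛ theta 1 c₂) n ≡⟨ theta-⊛ 4 1 c₂ c₂ n ⟩
      sumBall² n termV⁵       ∎
      where open ≡-Reasoning
    coeffUV : monomialAt u v (1 , 1) n ≡ sumBall² n termUV
    coeffUV = trans (⊛-cong (≗-trans (^-1 u) (bracket≗theta (+ 1))) (≗-trans (^-1 v) (bracket≗theta (+ 2))) n)
                    (theta-⊛ 1 1 c₁ c₂ n)
    coeffU²V² : monomialAt u v (2 , 2) n ≡ sumBall² n termU²V²
    coeffU²V² = trans (⊛-cong (≗-trans (^-cong 2 (bracket≗theta (+ 1))) (theta-^2 c₁))
                              (≗-trans (^-cong 2 (bracket≗theta (+ 2))) (theta-^2 c₂)) n)
                      (theta-⊛ 2 2 c₁ c₂ n)

module Supports where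

  open import Data.Bool using (Bool; true; false; _∧_)
  open import Data.Bool.Properties using (∧-zeroʳ; ∧-conicalˡ; ∧-conicalʳ; ∧-distribˡ-xor)
  open import Data.Empty using (⊥)
  open import Data.Nat as ℕ using (ℕ; zero; suc; _+_; _*_; _∸_; _%_; _≡ᵇ_; _<_; _≤_; NonZero)
  import Data.Nat.Properties as ℕP
  import Data.Nat.DivMod as ℕD
  open import Data.Nat.Divisibility using (_∣_)
  open import Data.Nat.Solver using (module +-*-Solver)
  open import Data.Product using (_,_)
  open import Data.Sum using (inj₁; inj₂)
  open import Function.Bundles using (mk⇔)
  open import Relation.Nullary.Decidable using (does-⇔)
  open import Relation.Binary.PropositionalEquality
  open import Defs
  open BoolSums
  open PowerSeries
  open IntegerResidues

  Supported : PS → (q : ℕ) → .{{NonZero q}} → ℕ → Set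
  Supported f q c = ∀ n → f n ≡ true → n % q ≡ c

  Supported-cong : ∀ {f g} q .{{_ : NonZero q}} c → f ≗ g → Supported f q c → Supported g q c
  Supported-cong q c f≗g supp n gn = supp n (trans (f≗g n) gn)

  Supported-one : ∀ q .{{_ : NonZero q}} → Supported onePS q 0
  Supported-one q zero    _  = ℕD.m*n%n≡0 0 q
  Supported-one q (suc n) ()

  Supported-⊛ : ∀ {f g} q .{{_ : NonZero q}} a b → Supported f q a → Supported g q b → Supported (f ⊛ g) q ((a + b) % q)
  Supported-⊛ {f} {g} q a b suppf suppg n fgn
    with sumAntidiagonal-witness n (λ i j → f i ∧ g j) (trans (sym (⊛-antidiagonal f g n)) fgn)
  ... | i , j , refl , figj = trans (ℕD.%-distribˡ-+ i j q)
    (cong₂ (λ x y → (x + y) % q) (suppf i (∧-conicalˡ _ _ figj)) (suppg j (∧-conicalʳ _ _ figj)))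

  %-absorbʳ : ∀ a b q .{{_ : NonZero q}} → (a + b % q) % q ≡ (a + b) % q
  %-absorbʳ a b q = trans (ℕD.%-distribˡ-+ a (b % q) q)
    (trans (cong (λ z → (a % q + z) % q) (ℕD.m%n%n≡m%n b q)) (sym (ℕD.%-distribˡ-+ a b q)))

  Supported-^ : ∀ {f} q .{{_ : NonZero q}} a k → Supported f q a → Supported (f ^PS k) q ((k * a) % q)
  Supported-^ q a zero    supp = subst (Supported onePS q) (sym (ℕD.m*n%n≡0 0 q)) (Supported-one q)
  Supported-^ q a (suc k) supp n e =
    trans (Supported-⊛ q a ((k * a) % q) supp (Supported-^ q a k supp) n e) (%-absorbʳ a (k * a) q)

  Supported-coarsen : ∀ {f} q .{{_ : NonZero q}} q′ .{{_ : NonZero q′}} c → q′ ∣ q → Supported f q c → Supported f q′ (c % q′)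
  Supported-coarsen q q′ c q′∣q supp n e = trans (sym (ℕD.m∣n⇒o%n%m≡o%m q′ q n q′∣q)) (cong (_% q′) (supp n e))

  double-%-double : ∀ k q → (k + k) % (suc q + suc q) ≡ k % suc q + k % suc q
  double-%-double k q = trans (cong (_% (suc q + suc q)) k+k≡)
    (trans (ℕD.[m+kn]%n≡m%n (r + r) t (suc q + suc q))
           (ℕD.m<n⇒m%n≡m (ℕP.+-mono-< (ℕD.m%n<n k (suc q)) (ℕD.m%n<n k (suc q)))))
    where
    open +-*-Solver
    r = k % suc q
    t = k ℕ./ suc q
    k+k≡ : k + k ≡ (r + r) + t * (suc q + suc q)
    k+k≡ = trans (cong₂ _+_ (ℕD.m≡m%n+[m/n]*n k (suc q)) (ℕD.m≡m%n+[m/n]*n k (suc q)))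
      (solve 3 (λ r t q → (r :+ t :* q) :+ (r :+ t :* q) := (r :+ r) :+ t :* (q :+ q)) refl r t (suc q))

  Supported-substX² : ∀ {f} q c → Supported f (suc q) c → Supported (substX² f) (suc q + suc q) (c + c)
  Supported-substX² {f} q c supp n e with even⊎odd n
  ... | k , inj₁ refl = trans (double-%-double k q) (cong₂ _+_ (supp k fk) (supp k fk))
    where
    fk : f k ≡ true
    fk = trans (sym (substX²-even f k)) e
  ... | k , inj₂ refl with () ← trans (sym e) (substX²-odd f k)

  projPS : (q : ℕ) → .{{NonZero q}} → ℕ → PS → PS
  projPS q r f n = (n % q ≡ᵇ r) ∧ f n

  projPS-cong : ∀ q .{{_ : NonZero q}} r {f g} → f ≗ g → projPS q r f ≗ projPS q r g
  projPS-cong q r f≗g n = cong ((n % q ≡ᵇ r) ∧_) (f≗g n)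

  projPS-⊕ : ∀ q .{{_ : NonZero q}} r f g → projPS q r (f ⊕ g) ≗ projPS q r f ⊕ projPS q r g
  projPS-⊕ q r f g n = ∧-distribˡ-xor (n % q ≡ᵇ r) (f n) (g n)

  projPS-Supported : ∀ q .{{_ : NonZero q}} r f → Supported f q r → projPS q r f ≗ f
  projPS-Supported q r f supp n with f n in fn
  ... | false = ∧-zeroʳ _
  ... | true rewrite supp n fn | ≡ᵇ-refl r = refl

  projPS-disjoint : ∀ q .{{_ : NonZero q}} r f q′ .{{_ : NonZero q′}} c → Supported f q′ c →
    (∀ n → n % q ≡ r → n % q′ ≡ c → ⊥) → projPS q r f ≗ zeroPS
  projPS-disjoint q r f q′ c supp disjoint n with f n in fn
  ... | false = ∧-zeroʳ _
  ... | true with n % q ≡ᵇ r in e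
  ... | false = refl
  ... | true with () ← disjoint n (≡ᵇ-true⇒≡ _ r e) (supp n fn)

  +-%-cancelˡ : ∀ q .{{_ : NonZero q}} a x y → a ≤ q → x < q → y < q → (a + x) % q ≡ (a + y) % q → x ≡ y
  +-%-cancelˡ q a x y a≤q x<q y<q e = trans (sym (undo x x<q)) (trans (cong (λ z → (z + (q ∸ a)) % q) e) (undo y y<q))
    where
    undo : ∀ z → z < q → ((a + z) % q + (q ∸ a)) % q ≡ z
    undo z z<q = begin
      ((a + z) % q + (q ∸ a)) % q ≡⟨ cong (_% q) (ℕP.+-comm ((a + z) % q) (q ∸ a)) ⟩
      ((q ∸ a) + (a + z) % q) % q ≡⟨ %-absorbʳ (q ∸ a) (a + z) q ⟩
      ((q ∸ a) + (a + z)) % q     ≡⟨ cong (_% q) (trans (sym (ℕP.+-assoc (q ∸ a) a z)) (cong (_+ z) (ℕP.m∸n+n≡m a≤q))) ⟩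
      (q + z) % q                 ≡⟨ trans (cong (_% q) (ℕP.+-comm q z)) (ℕD.[m+n]%n≡m%n z q) ⟩
      z % q                       ≡⟨ ℕD.m<n⇒m%n≡m z<q ⟩
      z                           ∎
      where open ≡-Reasoning

  projPS-⊛ : ∀ q .{{_ : NonZero q}} a r f g → Supported f q a → a < q → r < q →
    projPS q ((a + r) % q) (f ⊛ g) ≗ f ⊛ projPS q r g
  projPS-⊛ q a r f g supp a<q r<q n = begin
    (n % q ≡ᵇ (a + r) % q) ∧ (f ⊛ g) n
      ≡⟨ cong ((n % q ≡ᵇ (a + r) % q) ∧_) (⊛-antidiagonal f g n) ⟩
    (n % q ≡ᵇ (a + r) % q) ∧ sumAntidiagonal n (λ i j → f i ∧ g j)
      ≡⟨ sumAntidiagonal-∧ˡ n _ _ ⟩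
    sumAntidiagonal n (λ i j → (n % q ≡ᵇ (a + r) % q) ∧ (f i ∧ g j))
      ≡⟨ sumAntidiagonal-cong n term ⟩
    sumAntidiagonal n (λ i j → f i ∧ projPS q r g j)
      ≡⟨ sym (⊛-antidiagonal f (projPS q r g) n) ⟩
    (f ⊛ projPS q r g) n ∎
    where
    open ≡-Reasoning
    n%q : ∀ i j → i + j ≡ n → i % q ≡ a → n % q ≡ (a + j % q) % q
    n%q i j refl i%q = trans (ℕD.%-distribˡ-+ i j q) (cong (λ x → (x + j % q) % q) i%q)
    sameClass : ∀ i j → i + j ≡ n → i % q ≡ a → (n % q ≡ᵇ (a + r) % q) ≡ (j % q ≡ᵇ r)
    sameClass i j i+j i%q = does-⇔ (mk⇔
      (λ e → +-%-cancelˡ q a (j % q) r (ℕP.<⇒≤ a<q) (ℕD.m%n<n j q) r<q (trans (sym (n%q i j i+j i%q)) e))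
      (λ e → trans (n%q i j i+j i%q) (cong (λ z → (a + z) % q) e)))
      (n % q ℕ.≟ (a + r) % q) (j % q ℕ.≟ r)
    term : ∀ i j → i + j ≡ n → ((n % q ≡ᵇ (a + r) % q) ∧ (f i ∧ g j)) ≡ (f i ∧ projPS q r g j)
    term i j i+j with f i in fi
    ... | false = ∧-zeroʳ _
    ... | true  = cong (_∧ g j) (sameClass i j i+j (supp i fi))

module BracketSupports where

  open import Data.Bool using (Bool; true; false; _xor_; _∧_; not)
  open import Data.Bool.Properties using (∧-conicalˡ; ∧-conicalʳ)
  open import Data.Nat as ℕ using (ℕ; _≡ᵇ_)
  import Data.Nat.Properties as ℕP
  open import Data.Integer as ℤ using (ℤ; +_; _+_; -_)
  import Data.Integer.Properties as ℤP
  open import Data.Product using (Σ; _,_)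
  open import Relation.Binary.PropositionalEquality
  open import Defs
  open PowerSeries
  open Polynomials
  open IntegerResidues
  open BallSums
  open QuadraticForms
  open QuinticRelation
  open Supports

  theta-neg : ∀ w .{{_ : ℕ.NonZero w}} κ → theta w (λ a → κ (- a)) ≗ theta w κ
  theta-neg w κ n = trans (sumBall-cong n (λ a → cong (λ z → (w ℕ.* z ≡ᵇ n) ∧ κ (- a)) (∣-a∣²≡ a)))
    (sumBall-neg n (λ a → (w ℕ.* ∣ a ∣² ≡ᵇ n) ∧ κ a) (λ a e → ∣i∣≤-of-∣∣² w a n (∧-conicalˡ _ _ e)))
    where
    ∣-a∣²≡ : ∀ a → ∣ a ∣² ≡ ∣ - a ∣²
    ∣-a∣²≡ a = cong (λ z → z ℕ.* z) (sym (ℤP.∣-i∣≡∣i∣ a))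

  -- The even a contribute exactly θ 4 κ′ to θ 1 κ, and an odd square is 1 mod 8.
  theta-odd-support : ∀ κ κ′ → (∀ c → κ (c + c) ≡ κ′ c) → Supported (theta 1 κ ⊕ theta 4 κ′) 8 1
  theta-odd-support κ κ′ κ-double n e = fromWitness (sumBall-witness n oddTerm (trans oddPart e))
    where
    term oddTerm : ℤ → Bool
    term a = (1 ℕ.* ∣ a ∣² ≡ᵇ n) ∧ κ a
    oddTerm a = term a ∧ not (isEven a)
    split : ∀ p x → x ≡ (p ∧ x) xor (x ∧ not p)
    split false false = refl
    split false true  = refl
    split true  false = refl
    split true  true  = refl
    evenPart : sumBall n (λ a → isEven a ∧ term a) ≡ theta 4 κ′ n
    evenPart = trans (sym (sumBall-double n term (λ c k → ∣i∣≤-of-∣∣² 1 (c + c) n (∧-conicalˡ _ _ k))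
                                                   (λ y k → ∣i∣≤-of-∣∣² 1 y n (∧-conicalˡ _ _ k))))
      (sumBall-cong n (λ c → cong₂ _∧_ (cong (_≡ᵇ n) (∣double∣² c)) (κ-double c)))
    cancel : ∀ a b → (a xor b) xor a ≡ b
    cancel false false = refl
    cancel false true  = refl
    cancel true  false = refl
    cancel true  true  = refl
    oddPart : sumBall n oddTerm ≡ theta 1 κ n xor theta 4 κ′ n
    oddPart = begin
      sumBall n oddTerm
        ≡⟨ sym (cancel (theta 4 κ′ n) _) ⟩
      (theta 4 κ′ n xor sumBall n oddTerm) xor theta 4 κ′ n
        ≡⟨ cong (λ z → (z xor sumBall n oddTerm) xor theta 4 κ′ n) (sym evenPart) ⟩
      (sumBall n (λ a → isEven a ∧ term a) xor sumBall n oddTerm) xor theta 4 κ′ n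
        ≡⟨ cong (_xor theta 4 κ′ n) (sym (sumBall-xor n (λ a → isEven a ∧ term a) oddTerm)) ⟩
      sumBall n (λ a → (isEven a ∧ term a) xor oddTerm a) xor theta 4 κ′ n
        ≡⟨ cong (_xor theta 4 κ′ n) (sumBall-cong n (λ a → sym (split (isEven a) (term a)))) ⟩
      theta 1 κ n xor theta 4 κ′ n ∎
      where open ≡-Reasoning
    not-true : ∀ {x} → not x ≡ true → x ≡ false
    not-true {false} _ = refl
    fromWitness : Σ ℤ (λ a → oddTerm a ≡ true) → n ℕ.% 8 ≡ 1
    fromWitness (a , odd) = subst (λ m → m ℕ.% 8 ≡ 1)
      (trans (sym (ℕP.+-identityʳ ∣ a ∣²)) (≡ᵇ-true⇒≡ _ n (∧-conicalˡ _ _ (∧-conicalˡ _ _ odd))))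
      (odd⇒∣∣²%8≡1 a (not-true (∧-conicalʳ _ _ odd)))

  u⊕v^4-supported : Supported (u ⊕ (v ^PS 4)) 8 1
  u⊕v^4-supported = Supported-cong 8 1 (≗-sym (⊕-cong (bracket≗theta (+ 1)) (≗-trans v^4≗theta (≗-sym (theta-neg 4 (class5 (+ 2)))))))
    (theta-odd-support (class5 (+ 1)) (λ c → class5 (+ 2) (- c)) (λ c → trans (class5-double₁ c) (sym (class5-neg₂ c))))

  v⊕u^4-supported : Supported (v ⊕ (u ^PS 4)) 8 1
  v⊕u^4-supported = Supported-cong 8 1 (≗-sym (⊕-cong (bracket≗theta (+ 2)) u^4≗theta))
    (theta-odd-support (class5 (+ 2)) (class5 (+ 1)) class5-double₂)

module PowerProjections where

  open import Data.Bool using (Bool; true; false; _xor_; _∧_; _∨_; not; if_then_else_; T; T?)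
  open import Data.Bool.Properties using (xor-assoc; xor-comm; xor-same; xor-identityʳ; ∧-zeroʳ)
  open import Data.Empty using (⊥)
  open import Data.Nat as ℕ using (ℕ; suc; _+_; _*_; _%_; _≡ᵇ_; NonZero)
  import Data.Nat.Properties as ℕP
  import Data.Nat.DivMod as ℕD
  open import Data.Nat.Divisibility using (divides)
  open import Data.Nat.Solver using (module +-*-Solver)
  open import Data.List using (List; []; _∷_; _++_; filterᵇ)
  open import Data.List.Properties using (filter-accept; filter-reject)
  open import Data.List.Relation.Unary.All as All using (All; []; _∷_)
  open import Data.List.Relation.Unary.All.Properties using (all⁺)
  open import Data.Product using (_×_; _,_)
  open import Data.Sum using (inj₁; inj₂)
  open import Function using (_∘_)
  open import Relation.Binary.PropositionalEquality
  open import Defs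
  open PowerSeries
  open Polynomials
  open IntegerResidues
  open QuinticRelation
  open Supports

  %2-double : ∀ k → (k + k) % 2 ≡ 0
  %2-double k = trans (cong (_% 2) (solve 1 (λ k → k :+ k := con 0 :+ k :* con 2) refl k)) (ℕD.[m+kn]%n≡m%n 0 k 2)
    where open +-*-Solver

  %2-suc-double : ∀ k → suc (k + k) % 2 ≡ 1
  %2-suc-double k = trans (cong (_% 2) (solve 1 (λ k → con 1 :+ (k :+ k) := con 1 :+ k :* con 2) refl k)) (ℕD.[m+kn]%n≡m%n 1 k 2)
    where open +-*-Solver

  projPS-evalAt-filter : ∀ x y q .{{_ : NonZero q}} r (keep : ℕ × ℕ → Bool) L →
    All (λ m → projPS q r (monomialAt x y m) ≗ (if keep m then monomialAt x y m else zeroPS)) L →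
    projPS q r (evalAt x y L) ≗ evalAt x y (filterᵇ keep L)
  projPS-evalAt-filter x y q r keep []      []         n = ∧-zeroʳ _
  projPS-evalAt-filter x y q r keep (m ∷ L) (pm ∷ pL) = ≗-trans (projPS-⊕ q r _ _) (step (keep m) refl pm)
    where
    step : ∀ b → keep m ≡ b → projPS q r (monomialAt x y m) ≗ (if b then monomialAt x y m else zeroPS) →
      projPS q r (monomialAt x y m) ⊕ projPS q r (evalAt x y L) ≗ evalAt x y (filterᵇ keep (m ∷ L))
    step true  e pm′ rewrite filter-accept (T? ∘ keep) {xs = L} (subst T (sym e) _) =
      ⊕-cong pm′ (projPS-evalAt-filter x y q r keep L pL)
    step false e pm′ rewrite filter-reject (T? ∘ keep) {xs = L} (subst (λ b → T b → ⊥) (sym e) (λ ())) =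
      λ n → cong₂ _xor_ (pm′ n) (projPS-evalAt-filter x y q r keep L pL n)

  binomial : Poly2
  binomial = (1 , 0) ∷ (0 , 1) ∷ []

  -- With x = V⁴ and y = U + V⁴, the monomial xᵃyᵇ only has exponents ≡ b (mod 4), and ≡ b (mod 8)
  -- when a is even; so projecting U¹⁵ = (x + y)¹⁵ merely selects some of its monomials.
  module ProjectionsOfU^15 (U V : PS) (y-supported : Supported (U ⊕ (V ^PS 4)) 8 1)
                          (relation : evalAt U V quinticRelation ≗ zeroPS) where

    x y : PS
    x = V ^PS 4
    y = U ⊕ x

    U≗x⊕y : U ≗ x ⊕ y
    U≗x⊕y n = begin
      U n                   ≡⟨ sym (xor-identityʳ (U n)) ⟩
      U n xor false         ≡⟨ cong (U n xor_) (sym (xor-same (x n))) ⟩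
      U n xor (x n xor x n) ≡⟨ sym (xor-assoc (U n) (x n) (x n)) ⟩
      (U n xor x n) xor x n ≡⟨ xor-comm (y n) (x n) ⟩
      x n xor y n           ∎
      where open ≡-Reasoning

    x-supported : Supported x 4 0
    x-supported = Supported-cong 4 0 (≗-sym (^-4 V))
      (Supported-substX² 1 0 (Supported-substX² 0 0 (λ n _ → ℕD.n%1≡0 n)))

    x²-supported : Supported (x ^PS 2) 8 0
    x²-supported = Supported-cong 8 0 (≗-sym (^-2 x)) (Supported-substX² 3 0 x-supported)

    y-supported₄ : Supported y 4 1
    y-supported₄ = Supported-coarsen 8 4 1 (divides 2 refl) y-supported

    monomial-supported₄ : ∀ a b → Supported (monomialAt x y (a , b)) 4 (b % 4)
    monomial-supported₄ a b = subst (Supported (monomialAt x y (a , b)) 4) residue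
      (Supported-⊛ 4 ((a * 0) % 4) ((b * 1) % 4) (Supported-^ 4 0 a x-supported) (Supported-^ 4 1 b y-supported₄))
      where
      residue : ((a * 0) % 4 + (b * 1) % 4) % 4 ≡ b % 4
      residue rewrite ℕP.*-zeroʳ a | ℕP.*-identityʳ b = ℕD.m%n%n≡m%n b 4

    monomial-supported₈ : ∀ k b → Supported (monomialAt x y (k + k , b)) 8 (b % 8)
    monomial-supported₈ k b = subst (Supported (monomialAt x y (k + k , b)) 8) residue
      (Supported-cong 8 _ (⊛-congʳ (y ^PS b) (≗-sym (^-double x k)))
        (Supported-⊛ 8 ((k * 0) % 8) ((b * 1) % 8) (Supported-^ 8 0 k x²-supported) (Supported-^ 8 1 b y-supported)))
      where
      residue : ((k * 0) % 8 + (b * 1) % 8) % 8 ≡ b % 8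
      residue rewrite ℕP.*-zeroʳ k | ℕP.*-identityʳ b = ℕD.m%n%n≡m%n b 8

    keep₄ : ℕ → ℕ × ℕ → Bool
    keep₄ r (a , b) = b % 4 ≡ᵇ r

    projPS₄-monomial : ∀ r m → projPS 4 r (monomialAt x y m) ≗ (if keep₄ r m then monomialAt x y m else zeroPS)
    projPS₄-monomial r (a , b) with b % 4 ≡ᵇ r in e
    ... | true  = projPS-Supported 4 r _ (subst (Supported (monomialAt x y (a , b)) 4) (≡ᵇ-true⇒≡ _ r e) (monomial-supported₄ a b))
    ... | false = projPS-disjoint 4 r _ 4 (b % 4) (monomial-supported₄ a b) disjoint
      where
      disjoint : ∀ n → n % 4 ≡ r → n % 4 ≡ b % 4 → ⊥
      disjoint n n%4≡r n%4≡b%4 = ≡ᵇ-false⇒≢ e (trans (sym n%4≡b%4) n%4≡r)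

    keep₈ determined₈ : ℕ × ℕ → Bool
    keep₈ (a , b) = (a % 2 ≡ᵇ 0) ∧ (b % 8 ≡ᵇ 3)
    determined₈ (a , b) = (a % 2 ≡ᵇ 0) ∨ not (b % 4 ≡ᵇ 3)

    projPS₈-monomial : ∀ m → T (determined₈ m) →
      projPS 8 3 (monomialAt x y m) ≗ (if keep₈ m then monomialAt x y m else zeroPS)
    projPS₈-monomial (a , b) det with even⊎odd a
    ... | k , inj₁ refl rewrite %2-double k with b % 8 ≡ᵇ 3 in e
    ...   | true  = projPS-Supported 8 3 _ (subst (Supported (monomialAt x y (k + k , b)) 8) (≡ᵇ-true⇒≡ _ 3 e) (monomial-supported₈ k b))
    ...   | false = projPS-disjoint 8 3 _ 8 (b % 8) (monomial-supported₈ k b)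
                      (λ n n%8≡3 n%8≡b%8 → ≡ᵇ-false⇒≢ e (trans (sym n%8≡b%8) n%8≡3))
    projPS₈-monomial (a , b) det | k , inj₂ refl rewrite %2-suc-double k with b % 4 ≡ᵇ 3 in e
    ...   | false = projPS-disjoint 8 3 _ 4 (b % 4) (monomial-supported₄ (suc (k + k)) b) disjoint
      where
      disjoint : ∀ n → n % 8 ≡ 3 → n % 4 ≡ b % 4 → ⊥
      disjoint n n%8≡3 n%4≡b%4 = ≡ᵇ-false⇒≢ e
        (trans (sym n%4≡b%4) (trans (sym (ℕD.m∣n⇒o%n%m≡o%m 4 8 n (divides 2 refl))) (cong (_% 4) n%8≡3)))

    evalAt-binomial : ∀ f g → evalAt f g binomial ≗ f ⊕ g
    evalAt-binomial f g n = cong₂ _xor_ (trans (monomialAt-pureˡ f g 1 n) (^-1 f n))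
                                        (trans (xor-identityʳ _) (trans (monomialAt-pureʳ f g 1 n) (^-1 g n)))

    U^15≗ : U ^PS 15 ≗ evalAt x y (binomial ^ₚ 15)
    U^15≗ = ≗-trans (^-cong 15 (≗-trans U≗x⊕y (≗-sym (evalAt-binomial x y)))) (≗-sym (evalAt-^ₚ x y binomial 15))

    toUV : ∀ L → evalAt x y L ≗ evalAt U V (substVars ((0 , 4) ∷ []) ((1 , 0) ∷ (0 , 4) ∷ []) L)
    toUV L = ≗-trans (evalAt-cong L (≗-sym evalAt-x) (≗-sym evalAt-y)) (≗-sym (evalAt-substVars U V _ _ L))
      where
      evalAt-x : evalAt U V ((0 , 4) ∷ []) ≗ x
      evalAt-x n = trans (xor-identityʳ _) (monomialAt-pureʳ U V 4 n)
      evalAt-y : evalAt U V ((1 , 0) ∷ (0 , 4) ∷ []) ≗ y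
      evalAt-y n = cong₂ _xor_ (trans (monomialAt-pureˡ U V 1 n) (^-1 U n)) (evalAt-x n)

    certificate : ∀ T P W → normalize (T ++ (((16 , 0) ∷ []) *ₚ P) ++ (W *ₚ quinticRelation)) ≡ [] →
      evalAt U V T ≗ (U ^PS 16) ⊛ evalAt U V P
    certificate T P W e = begin
      evalAt U V T
        ≈⟨ evalAt-normalize-++ U V T ((((16 , 0) ∷ []) *ₚ P) ++ (W *ₚ quinticRelation)) e ⟩
      evalAt U V ((((16 , 0) ∷ []) *ₚ P) ++ (W *ₚ quinticRelation))
        ≈⟨ evalAt-++ U V (((16 , 0) ∷ []) *ₚ P) (W *ₚ quinticRelation) ⟩
      evalAt U V (((16 , 0) ∷ []) *ₚ P) ⊕ evalAt U V (W *ₚ quinticRelation)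
        ≈⟨ ⊕-cong (evalAt-*ₚ U V ((16 , 0) ∷ []) P) (evalAt-*ₚ U V W quinticRelation) ⟩
      (evalAt U V ((16 , 0) ∷ []) ⊛ evalAt U V P) ⊕ (evalAt U V W ⊛ evalAt U V quinticRelation)
        ≈⟨ ⊕-cong (⊛-congʳ (evalAt U V P) (λ n → trans (xor-identityʳ _) (monomialAt-pureˡ U V 16 n)))
                  (≗-trans (⊛-congˡ (evalAt U V W) relation) (⊛-zeroʳ (evalAt U V W))) ⟩
      ((U ^PS 16) ⊛ evalAt U V P) ⊕ zeroPS
        ≈⟨ ⊕-identityʳ ((U ^PS 16) ⊛ evalAt U V P) ⟩
      (U ^PS 16) ⊛ evalAt U V P ∎
      where open ≗-Reasoning

    proj₄₂ proj₄₁ proj₈₃ : Poly2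
    proj₄₂ = (0 , 6) ∷ (1 , 7) ∷ (2 , 3) ∷ (3 , 4) ∷ []
    proj₄₁ = (0 , 1) ∷ (0 , 6) ∷ (1 , 2) ∷ (1 , 7) ∷ (3 , 4) ∷ (4 , 0) ∷ []
    proj₈₃ = (0 , 11) ∷ (0 , 16) ∷ (1 , 12) ∷ (1 , 17) ∷ (2 , 18) ∷ (4 , 10) ∷ []

    toUV-filter : (ℕ × ℕ → Bool) → Poly2
    toUV-filter keep = substVars ((0 , 4) ∷ []) ((1 , 0) ∷ (0 , 4) ∷ []) (filterᵇ keep (binomial ^ₚ 15))

    projPS₄₂-U^15 : projPS 4 2 (U ^PS 15) ≗ (U ^PS 16) ⊛ evalAt U V proj₄₂
    projPS₄₂-U^15 = ≗-trans (projPS-cong 4 2 U^15≗)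
      (≗-trans (projPS-evalAt-filter x y 4 2 (keep₄ 2) (binomial ^ₚ 15) (All.universal (projPS₄-monomial 2) _))
      (≗-trans (toUV (filterᵇ (keep₄ 2) (binomial ^ₚ 15)))
               (certificate (toUV-filter (keep₄ 2)) proj₄₂ ((12 , 7) ∷ (13 , 3) ∷ (14 , 4) ∷ []) refl)))

    projPS₄₁-U^15 : projPS 4 1 (U ^PS 15) ≗ (U ^PS 16) ⊛ evalAt U V proj₄₁
    projPS₄₁-U^15 = ≗-trans (projPS-cong 4 1 U^15≗)
      (≗-trans (projPS-evalAt-filter x y 4 1 (keep₄ 1) (binomial ^ₚ 15) (All.universal (projPS₄-monomial 1) _))
      (≗-trans (toUV (filterᵇ (keep₄ 1) (binomial ^ₚ 15)))
               (certificate (toUV-filter (keep₄ 1)) proj₄₁ ((12 , 7) ∷ (14 , 4) ∷ (15 , 0) ∷ []) refl)))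

    projPS₈₃-U^15 : projPS 8 3 (U ^PS 15) ≗ (U ^PS 16) ⊛ evalAt U V proj₈₃
    projPS₈₃-U^15 = ≗-trans (projPS-cong 8 3 U^15≗)
      (≗-trans (projPS-evalAt-filter x y 8 3 keep₈ (binomial ^ₚ 15)
                  (All.map (λ {m} → projPS₈-monomial m) (all⁺ determined₈ (binomial ^ₚ 15) _)))
      (≗-trans (toUV (filterᵇ keep₈ (binomial ^ₚ 15)))
               (certificate (toUV-filter keep₈) proj₈₃
                 ((8 , 23) ∷ (10 , 15) ∷ (10 , 20) ∷ (11 , 16) ∷ (12 , 17) ∷ (13 , 18) ∷ (15 , 10) ∷ []) refl)))

module Cancellation where

  open import Data.Bool using (Bool; true; false; _xor_; _∧_)
  open import Data.Bool.Properties using (xor-same; xor-identityʳ; ∧-zeroʳ)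
  open import Data.Nat as ℕ using (ℕ; zero; suc; _+_; _%_; _<_; _≤_; z≤n; s≤s; NonZero)
  import Data.Nat.Properties as ℕP
  import Data.Nat.DivMod as ℕD
  open import Data.Sum using (inj₁; inj₂)
  open import Relation.Binary.PropositionalEquality
  open import Defs
  open BoolSums
  open PowerSeries
  open IntegerResidues
  open Supports

  ^8-supported : ∀ f → Supported (f ^PS 8) 8 0
  ^8-supported f = Supported-cong 8 0 (≗-sym (≗-trans (^-+ f 4 4) (⊛-self (f ^PS 4))))
    (Supported-substX² 3 0 (Supported-cong 4 0 (≗-sym (^-4 f))
      (Supported-substX² 1 0 (Supported-substX² 0 0 (λ n _ → ℕD.n%1≡0 n)))))

  ^16-supported : ∀ f → Supported (f ^PS 16) 8 0
  ^16-supported f = Supported-cong 8 0 (≗-sym (^-+ f 8 8)) (Supported-⊛ 8 0 0 (^8-supported f) (^8-supported f))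

  module Cancellable (U : PS) (d : ℕ) (low : ∀ i → i < d → U i ≡ false) (lead : U d ≡ true) where

    ⊛-leading : ∀ h n → (∀ k → k < n → h k ≡ false) → (U ⊛ h) (d + n) ≡ h n
    ⊛-leading h n below = trans (⊛-antidiagonal U h (d + n))
      (trans (sumAntidiagonal-shift d n _ (λ i j i<d → cong (_∧ h j) (low i i<d))) (go n below))
      where
      lead′ : U (d + 0) ≡ true
      lead′ = trans (cong U (ℕP.+-identityʳ d)) lead
      go : ∀ n → (∀ k → k < n → h k ≡ false) → sumAntidiagonal n (λ i j → U (d + i) ∧ h j) ≡ h n
      go zero    below = cong (_∧ h 0) lead′
      go (suc n) below = trans (cong₂ _xor_ (cong (_∧ h (suc n)) lead′)
        (sumAntidiagonal-zero n _ (λ i j i+j≡n → trans (cong (U (d + suc i) ∧_)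
          (below j (s≤s (subst (j ≤_) i+j≡n (ℕP.m≤n+m j i))))) (∧-zeroʳ _))))
        (xor-identityʳ (h (suc n)))

    ⊛-cancel-zero : ∀ h → U ⊛ h ≗ zeroPS → h ≗ zeroPS
    ⊛-cancel-zero h Uh≗0 n = vanishes (suc n) n ℕP.≤-refl
      where
      vanishes : ∀ m k → k < m → h k ≡ false
      vanishes (suc m) k (s≤s k≤m) with ℕP.m≤n⇒m<n∨m≡n k≤m
      ... | inj₁ k<m  = vanishes m k k<m
      ... | inj₂ refl = trans (sym (⊛-leading h k (vanishes k))) (Uh≗0 (d + k))

    ⊛-cancelˡ : ∀ h₁ h₂ → U ⊛ h₁ ≗ U ⊛ h₂ → h₁ ≗ h₂
    ⊛-cancelˡ h₁ h₂ e = ⊕-cancel h₁ h₂ (⊛-cancel-zero (h₁ ⊕ h₂)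
      (≗-trans (⊛-distribˡ-⊕ U h₁ h₂) (λ n → trans (cong (_xor (U ⊛ h₂) n) (e n)) (xor-same ((U ⊛ h₂) n)))))

    ^-⊛-cancelˡ : ∀ k h₁ h₂ → (U ^PS k) ⊛ h₁ ≗ (U ^PS k) ⊛ h₂ → h₁ ≗ h₂
    ^-⊛-cancelˡ zero    h₁ h₂ e = ≗-trans (≗-sym (⊛-identityˡ h₁)) (≗-trans e (⊛-identityˡ h₂))
    ^-⊛-cancelˡ (suc k) h₁ h₂ e = ^-⊛-cancelˡ k h₁ h₂
      (⊛-cancelˡ _ _ (≗-trans (≗-sym (⊛-assoc U (U ^PS k) h₁)) (≗-trans e (⊛-assoc U (U ^PS k) h₂))))

    -- U g = x^N gives U^(k+1) g = x^N U^k, and projection commutes with multiplication by U^(k+1).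
    projPS-inverse : ∀ q .{{_ : NonZero q}} j k F → j < q → Supported (U ^PS suc k) q 0 →
      projPS q j (U ^PS k) ≗ (U ^PS suc k) ⊛ F →
      ∀ N g → U ⊛ g ≗ xpow N → projPS q ((N % q + j) % q) g ≗ xpow N ⊛ F
    projPS-inverse q j k F j<q supp proj≗ N g Ug≗x^N = ^-⊛-cancelˡ (suc k) _ _ (begin
      (U ^PS suc k) ⊛ projPS q c g        ≈⟨ ≗-sym (subst (λ t → projPS q t ((U ^PS suc k) ⊛ g) ≗ (U ^PS suc k) ⊛ projPS q c g)
                                                        (ℕD.m<n⇒m%n≡m c<q) (projPS-⊛ q 0 c (U ^PS suc k) g supp 0<q c<q)) ⟩
      projPS q c ((U ^PS suc k) ⊛ g)      ≈⟨ projPS-cong q c U^k⁺¹g ⟩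
      projPS q c (xpow N ⊛ (U ^PS k))     ≈⟨ projPS-⊛ q (N % q) j (xpow N) (U ^PS k) x^N-supported (ℕD.m%n<n N q) j<q ⟩
      xpow N ⊛ projPS q j (U ^PS k)       ≈⟨ ⊛-congˡ (xpow N) proj≗ ⟩
      xpow N ⊛ ((U ^PS suc k) ⊛ F)        ≈⟨ ≗-sym (⊛-assoc (xpow N) (U ^PS suc k) F) ⟩
      (xpow N ⊛ (U ^PS suc k)) ⊛ F        ≈⟨ ⊛-congʳ F (⊛-comm (xpow N) (U ^PS suc k)) ⟩
      ((U ^PS suc k) ⊛ xpow N) ⊛ F        ≈⟨ ⊛-assoc (U ^PS suc k) (xpow N) F ⟩
      (U ^PS suc k) ⊛ (xpow N ⊛ F)        ∎)
      where
      open ≗-Reasoning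
      c = (N % q + j) % q
      c<q : c < q
      c<q = ℕD.m%n<n (N % q + j) q
      0<q : 0 < q
      0<q = ℕP.≤-<-trans z≤n j<q
      x^N-supported : Supported (xpow N) q (N % q)
      x^N-supported n e = cong (_% q) (sym (≡ᵇ-true⇒≡ N n e))
      U^k⁺¹g : (U ^PS suc k) ⊛ g ≗ xpow N ⊛ (U ^PS k)
      U^k⁺¹g = begin
        (U ^PS suc k) ⊛ g    ≈⟨ ⊛-congʳ g (⊛-comm U (U ^PS k)) ⟩
        ((U ^PS k) ⊛ U) ⊛ g  ≈⟨ ⊛-assoc (U ^PS k) U g ⟩
        (U ^PS k) ⊛ (U ⊛ g)  ≈⟨ ⊛-congˡ (U ^PS k) Ug≗x^N ⟩
        (U ^PS k) ⊛ xpow N   ≈⟨ ⊛-comm (U ^PS k) (xpow N) ⟩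
        xpow N ⊛ (U ^PS k)   ∎

module LaurentSeries where

  open import Data.Bool using (Bool; true; false; _∧_; if_then_else_)
  open import Data.Bool.Properties using (if-eta)
  open import Function.Bundles using (Equivalence; mk⇔)
  open import Data.Nat as ℕ using (ℕ; suc; _%_; _∸_; _<_; _≤?_; NonZero; s≤s; z≤n)
  import Data.Nat.Properties as ℕP
  import Data.Nat.DivMod as ℕD
  open import Data.Integer as ℤ using (ℤ; +_; -[1+_]; _-_; _+_)
  import Data.Integer.Properties as ℤP
  open import Data.Integer.Solver using (module +-*-Solver)
  open import Relation.Nullary using (yes; no)
  open import Relation.Nullary.Decidable using (does-⇔)
  open import Relation.Binary.PropositionalEquality
  open import Defs
  open PowerSeries
  open IntegerResidues
  open Supports

  lc-cong : ∀ N {f g} → f ≗ g → ∀ e → lc N f e ≡ lc N g e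
  lc-cong N f≗g e with e + + N
  ... | + k      = f≗g k
  ... | -[1+ k ] = refl

  lc-shiftBy : ∀ N F e → lc N (shiftBy N F) e ≡ psL F e
  lc-shiftBy N F (+ t) = trans (cong (shiftBy N F) (ℕP.+-comm t N))
    (trans (shiftBy-+ N F t) (cong F (sym (ℕP.+-identityʳ t))))
  lc-shiftBy N F -[1+ t ] with suc t ≤? N
  ... | yes t<N = trans (cong (lcAux (shiftBy N F)) (ℤP.⊖-≥ t<N)) (shiftBy-< N F (N ∸ suc t) (ℕP.∸-monoʳ-< (s≤s z≤n) t<N))
  ... | no  t≮N = cong (lcAux (shiftBy N F))
    (trans (ℤP.⊖-< (ℕP.≰⇒> t≮N)) (cong (λ z → ℤ.-_ (+ z)) (ℕP.+-∸-assoc 1 (ℕP.≤-pred (ℕP.≰⇒> t≮N)))))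

  proj-lc : ∀ q .{{_ : NonZero q}} j N g → j < q → ∀ e → proj q j (lc N g) e ≡ lc N (projPS q ((N % q ℕ.+ j) % q) g) e
  proj-lc q j N g j<q e with e + + N in e+N
  ... | + k      = trans (if-then-false _ (g k)) (cong (_∧ g k) sameClass)
    where
    open +-*-Solver
    if-then-false : ∀ b x → (if b then x else false) ≡ b ∧ x
    if-then-false false x = refl
    if-then-false true  x = refl
    e-j : e - + j ≡ + k - + (N ℕ.+ j)
    e-j = begin
      e - + j                ≡⟨ solve 3 (λ e n j → e :- j := (e :+ n) :- (n :+ j)) refl e (+ N) (+ j) ⟩
      (e + + N) - (+ N + + j) ≡⟨ cong₂ _-_ e+N (ℤP.pos-+ N j) ⟩
      + k - + (N ℕ.+ j)      ∎
      where open ≡-Reasoning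
    N+j : (N ℕ.+ j) % q ≡ (N % q ℕ.+ j) % q
    N+j = trans (ℕD.%-distribˡ-+ N j q) (cong (λ z → (N % q ℕ.+ z) % q) (ℕD.m<n⇒m%n≡m j<q))
    sameClass : ((e - + j) ℤ.%ℕ q ℕ.≡ᵇ 0) ≡ (k % q ℕ.≡ᵇ (N % q ℕ.+ j) % q)
    sameClass = trans (cong (λ z → z ℤ.%ℕ q ℕ.≡ᵇ 0) e-j)
      (does-⇔ (mk⇔ (λ h → trans (to h) N+j) (λ h → from (trans h (sym N+j)))) ((+ k - + (N ℕ.+ j)) ℤ.%ℕ q ℕ.≟ 0) (k % q ℕ.≟ _))
      where open Equivalence (Mod.-+-%ℕ≡0⇔ q k (N ℕ.+ j))
  ... | -[1+ k ] = if-eta ((e - + j) ℤ.%ℕ q ℕ.≡ᵇ 0)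

open BoolSums
open PowerSeries
open Polynomials
open IntegerResidues
open BallSums
open QuadraticForms
open QuinticRelation
open Supports
open BracketSupports
open PowerProjections
open Cancellation
open LaurentSeries

quinticRelation-holds-swapped : evalAt v u quinticRelation ≗ zeroPS
quinticRelation-holds-swapped = ≗-trans (evalAt-swapVars v u quinticRelation)
  (≗-trans (evalAt-normalize-++ u v (swapVars quinticRelation) quinticRelation refl) quinticRelation-holds)

u-low : ∀ i → i < 1 → u i ≡ false
u-low zero _ = refl
u-low (suc i) (s≤s ())

v-low : ∀ i → i < 4 → v i ≡ false
v-low 0 _ = refl
v-low 1 _ = refl
v-low 2 _ = refl
v-low 3 _ = refl
v-low (suc (suc (suc (suc i)))) (s≤s (s≤s (s≤s (s≤s ()))))

module Inverse (U V : PS) (y-supported : Supported (U ⊕ (V ^PS 4)) 8 1)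
               (relation : evalAt U V quinticRelation ≗ zeroPS)
               (d : ℕ) (low : ∀ i → i < d → U i ≡ false) (lead : U d ≡ true)
               (toS : Poly2 → Poly2) (toS-correct : ∀ P → evalAt U V P ≗ evalAt u v (toS P)) where
  open ProjectionsOfU^15 U V y-supported relation
  open Cancellable U d low lead

  projection-in-S : ∀ q .{{_ : NonZero q}} j P → j < q → Supported (U ^PS 16) q 0 →
    projPS q j (U ^PS 15) ≗ (U ^PS 16) ⊛ evalAt U V P → ∀ N g → U ⊛ g ≗ xpow N → InS (proj q j (lc N g))
  projection-in-S q j P j<q supported projection N g Ug≗x^N = toS P , λ e → begin
    proj q j (lc N g) e                    ≡⟨ proj-lc q j N g j<q e ⟩
    lc N (projPS q ((N % q ℕ.+ j) % q) g) e ≡⟨ lc-cong N (projPS-inverse q j 15 F j<q supported projection N g Ug≗x^N) e ⟩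
    lc N (xpow N ⊛ F) e                    ≡⟨ lc-cong N (xpow-⊛ N F) e ⟩
    lc N (shiftBy N F) e                   ≡⟨ lc-shiftBy N F e ⟩
    psL F e                                ≡⟨ lc-cong 0 (≗-trans (toS-correct P) (≗-sym (evalS≗evalAt (toS P)))) e ⟩
    psL (evalS (toS P)) e                 ∎
    where
    open ≡-Reasoning
    F = evalAt U V P

  projections-in-S : ∀ N g → U ⊛ g ≗ xpow N →
    InS (proj 4 2 (lc N g)) × InS (proj 4 1 (lc N g)) × InS (proj 8 3 (lc N g))
  projections-in-S N g Ug≗x^N =
    projection-in-S 4 2 proj₄₂ (s≤s (s≤s (s≤s z≤n))) ^16-supported₄ projPS₄₂-U^15 N g Ug≗x^N ,
    projection-in-S 4 1 proj₄₁ (s≤s (s≤s z≤n)) ^16-supported₄ projPS₄₁-U^15 N g Ug≗x^N ,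
    projection-in-S 8 3 proj₈₃ (s≤s (s≤s (s≤s (s≤s z≤n)))) (^16-supported U) projPS₈₃-U^15 N g Ug≗x^N
    where
    ^16-supported₄ : Supported (U ^PS 16) 4 0
    ^16-supported₄ = Supported-coarsen 8 4 0 (divides 2 refl) (^16-supported U)

theorem4p2 : (r : ℕ) → (r ≡ 1 ⊎ r ≡ 2) →
    (N : ℕ) (g : PS) → (∀ n → (bracket (+ r) ⊛ g) n ≡ xpow N n) →
    InS (proj 4 2 (lc N g)) × InS (proj 4 1 (lc N g)) × InS (proj 8 3 (lc N g))
theorem4p2 r (inj₁ refl) = Inverse.projections-in-S u v u⊕v^4-supported quinticRelation-holds
  1 u-low refl id (λ P → ≗-refl)
theorem4p2 r (inj₂ refl) = Inverse.projections-in-S v u v⊕u^4-supported quinticRelation-holds-swapped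
  4 v-low refl swapVars (evalAt-swapVars v u)
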